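{- Let $N$ and $n$ be positive integers. Then $$ c_{N,n}=n!\sum_{t_1+2t_2+\cdots+nt_n=n}\binom{t_1+\cdots+t_n}{t_1,\dots,t_n}(-1)^{n-t_1-\cdots-t_n}\left(\frac{N}{N+1}\right)^{t_1}\left(\frac{N}{N+2}\right)^{t_2}\cdots\left(\frac{N}{N+n}\right)^{t_n}, $$ where the sum is over nonnegative integers $t_1,\dots,t_n$ and $\binom{t_1+\cdots+t_n}{t_1,\dots,t_n}=\frac{(t_1+\cdots+t_n)!}{t_1!\cdots t_n!}$; and $$ \frac{N}{N+n}=\det\begin{pmatrix}\frac{c_{N,1}}{1!}&1&&\\ \frac{c_{N,2}}{2!}&\ddots&\ddots&\\ \vdots&\ddots&\ddots&1\\ \frac{c_{N,n}}{n!}&\cdots&\frac{c_{N,2}}{2!}&\frac{c_{N,1}}{1!}\end{pmatrix}, $$ the $n\times n$ matrix with $(i,j)$ entry $c_{N,i-j+1}/(i-j+1)!$ for $j\le i$, $1$ for $j=i+1$, $0$ for $j\ge i+2$.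
   Context: For a positive integer $N$, the hypergeometric Cauchy numbers $c_{N,n}$ ($n\ge 0$) are defined by the formal power series identity $$\frac{1}{{}_2F_1(1,N;N+1;-x)}=\frac{(-1)^{N-1}x^N/N}{\log(1+x)-\sum_{k=1}^{N-1}(-1)^{k-1}x^k/k}=\sum_{n=0}^\infty c_{N,n}\frac{x^n}{n!},$$ where ${}_2F_1(a,b;c;z)=\sum_{n\ge0}\frac{(a)^{(n)}(b)^{(n)}}{(c)^{(n)}}\frac{z^n}{n!}$ is the Gauss hypergeometric function and $(x)^{(n)}=x(x+1)\cdots(x+n-1)$, $(x)^{(0)}=1$. -}

module Defs where

open import Data.Nat as ℕ using (ℕ; zero; suc)
open import Data.Nat.Combinatorics using ()
open import Data.Integer using (ℤ; +_)
open import Data.Rational using (ℚ; 0ℚ; 1ℚ; _+_; _*_; -_; _/_)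
open import Data.Fin using (Fin; zero; suc; toℕ; punchIn)
open import Data.List using (List; []; _∷_; map; concatMap; filter; upTo)
import Data.List as L
open import Data.Vec using (Vec; []; _∷_; lookup)
open import Data.Bool using (if_then_else_)
open import Relation.Nullary.Decidable using (⌊_⌋)
open import Relation.Nullary using (yes; no)
open import Relation.Binary.PropositionalEquality using (_≡_)

ℕ→ℚ : ℕ → ℚ
ℕ→ℚ n = (+ n) / 1

-- a / d for naturals; d = 0 is a junk value (never used with d = 0 here)
_/ℕ_ : ℕ → ℕ → ℚ
a /ℕ zero = 0ℚ
a /ℕ suc d = (+ a) / suc d

_^ℚ_ : ℚ → ℕ → ℚ
x ^ℚ zero = 1ℚ
x ^ℚ suc k = x * (x ^ℚ k)

sgn : ℕ → ℚ
sgn k = (- 1ℚ) ^ℚ k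

fact : ℕ → ℕ
fact zero = 1
fact (suc n) = suc n ℕ.* fact n

rising : ℕ → ℕ → ℕ
rising x zero = 1
rising x (suc n) = rising x n ℕ.* (x ℕ.+ n)

Σ< : ℕ → (ℕ → ℚ) → ℚ
Σ< zero f = 0ℚ
Σ< (suc n) f = Σ< n f + f n

ΣFin : (n : ℕ) → (Fin n → ℚ) → ℚ
ΣFin zero f = 0ℚ
ΣFin (suc n) f = f zero + ΣFin n (λ i → f (suc i))

-- n-th coefficient (in z) of the Gauss hypergeometric series 2F1(a,b;c;z) for
-- natural parameters a, b, c:  (a)^(n) (b)^(n) / ((c)^(n) n!)
hyp2F1 : ℕ → ℕ → ℕ → ℕ → ℚ
hyp2F1 a b c n = (rising a n ℕ.* rising b n) /ℕ (rising c n ℕ.* fact n)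

-- coefficient of x^n in 2F1(1,N;N+1;-x)
Fcoeff : ℕ → ℕ → ℚ
Fcoeff N n = sgn n * hyp2F1 1 N (suc N) n

-- c is the sequence of hypergeometric Cauchy numbers c_{N,n}:
-- 2F1(1,N;N+1;-x) * Σ_n c n x^n/n! = 1 as formal power series
IsHypCauchy : ℕ → (ℕ → ℚ) → Set
IsHypCauchy N c = ∀ m →
  Σ< (suc m) (λ k → Fcoeff N k * (c (m ℕ.∸ k) * (1 /ℕ fact (m ℕ.∸ k))))
    ≡ (if ⌊ m ℕ.≟ 0 ⌋ then 1ℚ else 0ℚ)

det : (n : ℕ) → (Fin n → Fin n → ℚ) → ℚ
det zero M = 1ℚ
det (suc n) M = ΣFin (suc n) (λ j → sgn (toℕ j) * (M zero j * det n (λ i k → M (suc i) (punchIn j k))))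

allVecs : ℕ → (k : ℕ) → List (Vec ℕ k)
allVecs b zero = [] ∷ []
allVecs b (suc k) = concatMap (λ x → map (x ∷_) (allVecs b k)) (upTo (suc b))

sumV : ∀ {k} → Vec ℕ k → ℕ
sumV [] = 0
sumV (x ∷ v) = x ℕ.+ sumV v

weighted : ∀ {k} → ℕ → Vec ℕ k → ℕ
weighted i [] = 0
weighted i (x ∷ v) = i ℕ.* x ℕ.+ weighted (suc i) v

prodFact : ∀ {k} → Vec ℕ k → ℕ
prodFact [] = 1
prodFact (x ∷ v) = fact x ℕ.* prodFact v

multinom : ∀ {k} → Vec ℕ k → ℚ
multinom t = fact (sumV t) /ℕ prodFact t

powProd : ℕ → ∀ {k} → ℕ → Vec ℕ k → ℚ
powProd N i [] = 1ℚ
powProd N i (x ∷ v) = ((N /ℕ (N ℕ.+ i)) ^ℚ x) * powProd N (suc i) v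

sumL : List ℚ → ℚ
sumL = L.foldr _+_ 0ℚ

-- the sum over nonnegative t_1..t_n with t_1 + 2t_2 + … + n t_n = n
-- (each t_i ≤ n is forced by the constraint, so enumerating {0..n}^n is complete)
cauchySum : ℕ → ℕ → ℚ
cauchySum N n = sumL (map term (filter (λ t → weighted 1 t ℕ.≟ n) (allVecs n n)))
  where
  term : Vec ℕ n → ℚ
  term t = multinom t * (sgn (n ℕ.∸ sumV t) * powProd N 1 t)

-- the n×n Toeplitz–Hessenberg matrix, 0-based indices i, j:
-- entry c_{i-j+1}/(i-j+1)! if j ≤ i, 1 if j = i+1, 0 otherwise
cauchyMatrix : (ℕ → ℚ) → (n : ℕ) → Fin n → Fin n → ℚ
cauchyMatrix c n i j with toℕ j ℕ.≤? toℕ i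
... | yes _ = c (suc (toℕ i ℕ.∸ toℕ j)) * (1 /ℕ fact (suc (toℕ i ℕ.∸ toℕ j)))
... | no _ = if ⌊ toℕ j ℕ.≟ suc (toℕ i) ⌋ then 1ℚ else 0ℚ

module Submission where

-- Write a m = c_{N,m} / m! and b m = (-1)^m N / (N + m) for the coefficients of ₂F₁(1, N; N + 1; -x).
-- The defining identity says that b is the convolution inverse of a, i.e. a₀ = 1 and
-- a_{m+1} = Σ_{j ≤ m} (-b_{j+1}) a_{m-j}. Unrolling this recursion and grouping the compositions of n by
-- their multiplicities t gives the multinomial sum (Trudi's formula); it is proved by summing the Pascal
-- rule for multinomial coefficients over the box {0, …, n}^n. Expanding the Toeplitz–Hessenberg determinant
-- D_n along its first row gives D_{n+1} = Σ_{m ≤ n} (-1)^m a_{m+1} D_{n-m}, a recursion which (-1)^n b_n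
-- also satisfies because b is inverse to a; hence D_n = N / (N + n).

module HypergeometricCauchyNumbers where

  open import Defs
  open import Data.Nat as ℕ using (ℕ; zero; suc; z≤n; s≤s; _!)
  import Data.Nat.Properties as ℕP
  open import Data.Nat.Combinatorics using (_C_; nCn≡1; nCk+nC[k+1]≡[n+1]C[k+1]; nCk≡n!/k![n-k]!; k![n∸k]!∣n!)
  open import Data.Nat.DivMod using (m/n*n≡m)
  open import Data.Nat.Induction using (<-rec)
  import Data.Integer as ℤ
  import Data.Integer.Properties as ℤP
  open import Data.Rational using (ℚ; 0ℚ; 1ℚ; _+_; _*_; -_; toℚᵘ)
  open import Data.Rational.Properties
    using (+-identityˡ; +-identityʳ; +-assoc; +-comm; *-identityˡ; *-identityʳ; *-zeroˡ; *-zeroʳ; *-assoc; *-distribˡ-+;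
           +-0-group; *-1-commutativeMonoid; fromℚᵘ-cong; toℚᵘ-injective; toℚᵘ-homo-*; toℚᵘ-homo-+; toℚᵘ-fromℚᵘ)
  open import Data.Rational.Solver using (module +-*-Solver)
  import Data.Rational.Unnormalised as ℚᵘ
  import Data.Rational.Unnormalised.Properties as ℚᵘP
  open import Algebra.Properties.CommutativeSemigroup ℕP.*-commutativeSemigroup using (x∙yz≈y∙xz; x∙yz≈yx∙z)
  open import Algebra.Properties.Group +-0-group using (inverseˡ-unique)
  open import Algebra.Solver.CommutativeMonoid *-1-commutativeMonoid using (_⊕_; _⊜_) renaming (solve to *-solve)
  open import Data.Fin using (Fin; zero; suc; toℕ; punchIn)
  open import Data.Vec using (Vec; []; _∷_)
  open import Data.List using (List; []; _∷_; map; filter; concatMap; upTo; applyUpTo; _++_)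
  import Data.List.Properties as ListP
  import Data.List.Relation.Unary.All as All
  open import Data.List.Relation.Unary.All.Properties using (all-filter)
  open import Data.Bool using (if_then_else_)
  open import Data.Empty using (⊥-elim)
  open import Data.Sum using (_⊎_; inj₁; inj₂)
  open import Level using (0ℓ)
  open import Relation.Nullary using (¬_; yes; no)
  open import Relation.Nullary.Decidable using (⌊_⌋)
  open import Relation.Unary using (Pred; Decidable)
  open import Relation.Binary.PropositionalEquality hiding ([_])
  open +-*-Solver

  /ℕ-cross : ∀ a b d e → a ℕ.* suc e ≡ b ℕ.* suc d → a /ℕ suc d ≡ b /ℕ suc e
  /ℕ-cross a b d e eq = fromℚᵘ-cong {ℚᵘ.mkℚᵘ (ℤ.+ a) d} {ℚᵘ.mkℚᵘ (ℤ.+ b) e} (ℚᵘ.*≡* (begin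
    ℤ.+ a ℤ.* ℤ.+ suc e ≡⟨ ℤP.pos-* a (suc e) ⟨
    ℤ.+ (a ℕ.* suc e) ≡⟨ cong ℤ.+_ eq ⟩
    ℤ.+ (b ℕ.* suc d) ≡⟨ ℤP.pos-* b (suc d) ⟩
    ℤ.+ b ℤ.* ℤ.+ suc d ∎))
    where open ≡-Reasoning

  /ℕ-≡ : ∀ a b {d e} → 0 ℕ.< d → 0 ℕ.< e → a ℕ.* e ≡ b ℕ.* d → a /ℕ d ≡ b /ℕ e
  /ℕ-≡ a b {suc d} {suc e} _ _ = /ℕ-cross a b d e

  /ℕ-* : ∀ a b d e → (a /ℕ suc d) * (b /ℕ suc e) ≡ (a ℕ.* b) /ℕ (suc d ℕ.* suc e)
  /ℕ-* a b d e = toℚᵘ-injective (begin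
    toℚᵘ ((a /ℕ suc d) * (b /ℕ suc e))
      ≈⟨ toℚᵘ-homo-* (a /ℕ suc d) (b /ℕ suc e) ⟩
    toℚᵘ (a /ℕ suc d) ℚᵘ.* toℚᵘ (b /ℕ suc e)
      ≈⟨ ℚᵘP.*-cong (toℚᵘ-fromℚᵘ (ℚᵘ.mkℚᵘ (ℤ.+ a) d)) (toℚᵘ-fromℚᵘ (ℚᵘ.mkℚᵘ (ℤ.+ b) e)) ⟩
    ℚᵘ.mkℚᵘ (ℤ.+ a ℤ.* ℤ.+ b) (e ℕ.+ d ℕ.* suc e)
      ≡⟨ cong (λ z → ℚᵘ.mkℚᵘ z (e ℕ.+ d ℕ.* suc e)) (ℤP.pos-* a b) ⟨
    ℚᵘ.mkℚᵘ (ℤ.+ (a ℕ.* b)) (e ℕ.+ d ℕ.* suc e)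
      ≈⟨ toℚᵘ-fromℚᵘ (ℚᵘ.mkℚᵘ (ℤ.+ (a ℕ.* b)) (e ℕ.+ d ℕ.* suc e)) ⟨
    toℚᵘ ((a ℕ.* b) /ℕ (suc d ℕ.* suc e)) ∎)
    where open ℚᵘP.≃-Reasoning

  /ℕ-+ : ∀ a b d e → (a /ℕ suc d) + (b /ℕ suc e) ≡ (a ℕ.* suc e ℕ.+ b ℕ.* suc d) /ℕ (suc d ℕ.* suc e)
  /ℕ-+ a b d e = toℚᵘ-injective (begin
    toℚᵘ ((a /ℕ suc d) + (b /ℕ suc e))
      ≈⟨ toℚᵘ-homo-+ (a /ℕ suc d) (b /ℕ suc e) ⟩
    toℚᵘ (a /ℕ suc d) ℚᵘ.+ toℚᵘ (b /ℕ suc e)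
      ≈⟨ ℚᵘP.+-cong (toℚᵘ-fromℚᵘ (ℚᵘ.mkℚᵘ (ℤ.+ a) d)) (toℚᵘ-fromℚᵘ (ℚᵘ.mkℚᵘ (ℤ.+ b) e)) ⟩
    ℚᵘ.mkℚᵘ (ℤ.+ a ℤ.* ℤ.+ suc e ℤ.+ ℤ.+ b ℤ.* ℤ.+ suc d) (e ℕ.+ d ℕ.* suc e)
      ≡⟨ cong (λ z → ℚᵘ.mkℚᵘ z (e ℕ.+ d ℕ.* suc e)) numerator ⟨
    ℚᵘ.mkℚᵘ (ℤ.+ (a ℕ.* suc e ℕ.+ b ℕ.* suc d)) (e ℕ.+ d ℕ.* suc e)
      ≈⟨ toℚᵘ-fromℚᵘ (ℚᵘ.mkℚᵘ (ℤ.+ (a ℕ.* suc e ℕ.+ b ℕ.* suc d)) (e ℕ.+ d ℕ.* suc e)) ⟨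
    toℚᵘ ((a ℕ.* suc e ℕ.+ b ℕ.* suc d) /ℕ (suc d ℕ.* suc e)) ∎)
    where
    open ℚᵘP.≃-Reasoning
    numerator : ℤ.+ (a ℕ.* suc e ℕ.+ b ℕ.* suc d) ≡ ℤ.+ a ℤ.* ℤ.+ suc e ℤ.+ ℤ.+ b ℤ.* ℤ.+ suc d
    numerator = trans (ℤP.pos-+ (a ℕ.* suc e) (b ℕ.* suc d)) (cong₂ ℤ._+_ (ℤP.pos-* a (suc e)) (ℤP.pos-* b (suc d)))

  ℕ→ℚ-+ : ∀ a b → ℕ→ℚ (a ℕ.+ b) ≡ ℕ→ℚ a + ℕ→ℚ b
  ℕ→ℚ-+ a b = sym (trans (/ℕ-+ a b 0 0) (/ℕ-cross (a ℕ.* 1 ℕ.+ b ℕ.* 1) (a ℕ.+ b) 0 0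
    (cong₂ (λ u v → (u ℕ.+ v) ℕ.* 1) (ℕP.*-identityʳ a) (ℕP.*-identityʳ b))))

  ℕ→ℚ-* : ∀ a b → ℕ→ℚ (a ℕ.* b) ≡ ℕ→ℚ a * ℕ→ℚ b
  ℕ→ℚ-* a b = sym (/ℕ-* a b 0 0)

  ℕ→ℚ-*-1/ℕ : ∀ d → 0 ℕ.< d → ℕ→ℚ d * (1 /ℕ d) ≡ 1ℚ
  ℕ→ℚ-*-1/ℕ (suc d) _ = trans (/ℕ-* (suc d) 1 0 d) (/ℕ-cross (suc d ℕ.* 1) 1 (d ℕ.+ 0 ℕ.* suc d) 0 (begin
    suc d ℕ.* 1 ℕ.* 1     ≡⟨ ℕP.*-identityʳ _ ⟩
    suc d ℕ.* 1           ≡⟨ ℕP.*-identityʳ _ ⟩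
    suc d                 ≡⟨ cong suc (ℕP.+-identityʳ d) ⟨
    suc (d ℕ.+ 0)         ≡⟨ ℕP.*-identityˡ _ ⟨
    1 ℕ.* suc (d ℕ.+ 0) ∎))
    where open ≡-Reasoning

  ^ℚ-+ : ∀ x a b → x ^ℚ (a ℕ.+ b) ≡ x ^ℚ a * x ^ℚ b
  ^ℚ-+ x zero    b = sym (*-identityˡ _)
  ^ℚ-+ x (suc a) b rewrite ^ℚ-+ x a b = sym (*-assoc x (x ^ℚ a) (x ^ℚ b))

  ^ℚ-*-assoc : ∀ x a b → (x ^ℚ a) ^ℚ b ≡ x ^ℚ (a ℕ.* b)
  ^ℚ-*-assoc x a zero    rewrite ℕP.*-zeroʳ a = refl
  ^ℚ-*-assoc x a (suc b) rewrite ℕP.*-suc a b | ^ℚ-+ x a (a ℕ.* b) | ^ℚ-*-assoc x a b = refl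

  *-distrib-^ℚ : ∀ x y a → (x * y) ^ℚ a ≡ x ^ℚ a * y ^ℚ a
  *-distrib-^ℚ x y zero    = refl
  *-distrib-^ℚ x y (suc a) rewrite *-distrib-^ℚ x y a =
    *-solve 4 (λ x y p q → (x ⊕ y) ⊕ (p ⊕ q) ⊜ (x ⊕ p) ⊕ (y ⊕ q)) refl x y (x ^ℚ a) (y ^ℚ a)

  sgn-+ : ∀ a b → sgn (a ℕ.+ b) ≡ sgn a * sgn b
  sgn-+ = ^ℚ-+ (- 1ℚ)

  sgn-*-sgn : ∀ n → sgn n * sgn n ≡ 1ℚ
  sgn-*-sgn zero    = refl
  sgn-*-sgn (suc n) = begin
    (- 1ℚ * sgn n) * (- 1ℚ * sgn n) ≡⟨ solve 1 (λ s → (con (- 1ℚ) :* s) :* (con (- 1ℚ) :* s) := s :* s) refl (sgn n) ⟩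
    sgn n * sgn n                   ≡⟨ sgn-*-sgn n ⟩
    1ℚ                              ∎
    where open ≡-Reasoning

  sgn-∸ : ∀ {m n} → m ℕ.≤ n → sgn m * sgn (n ℕ.∸ m) ≡ sgn n
  sgn-∸ {m} {n} m≤n = trans (sym (sgn-+ m (n ℕ.∸ m))) (cong sgn (ℕP.m+[n∸m]≡n m≤n))

  [_≤_] : ℕ → ℕ → ℚ
  [ a ≤ b ] = if ⌊ a ℕ.≤? b ⌋ then 1ℚ else 0ℚ

  [_≡_] : ℕ → ℕ → ℚ
  [ a ≡ b ] = if ⌊ a ℕ.≟ b ⌋ then 1ℚ else 0ℚ

  [≤]-yes : ∀ {a b} → a ℕ.≤ b → [ a ≤ b ] ≡ 1ℚ
  [≤]-yes {a} {b} a≤b with a ℕ.≤? b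
  ... | yes _ = refl
  ... | no a≰b = ⊥-elim (a≰b a≤b)

  [≤]-no : ∀ {a b} → ¬ a ℕ.≤ b → [ a ≤ b ] ≡ 0ℚ
  [≤]-no {a} {b} a≰b with a ℕ.≤? b
  ... | yes a≤b = ⊥-elim (a≰b a≤b)
  ... | no _ = refl

  [≡]-yes : ∀ {a b} → a ≡ b → [ a ≡ b ] ≡ 1ℚ
  [≡]-yes {a} {b} a≡b with a ℕ.≟ b
  ... | yes _ = refl
  ... | no a≢b = ⊥-elim (a≢b a≡b)

  [≡]-no : ∀ {a b} → a ≢ b → [ a ≡ b ] ≡ 0ℚ
  [≡]-no {a} {b} a≢b with a ℕ.≟ b
  ... | yes a≡b = ⊥-elim (a≢b a≡b)
  ... | no _ = refl

  if-≟≡[≡]* : ∀ a b x → (if ⌊ a ℕ.≟ b ⌋ then x else 0ℚ) ≡ [ a ≡ b ] * x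
  if-≟≡[≡]* a b x with a ℕ.≟ b
  ... | yes _ = sym (*-identityˡ x)
  ... | no  _ = sym (*-zeroˡ x)

  [≤]-split : ∀ a b m → [ a ≤ m ] * [ b ≤ m ℕ.∸ a ] ≡ [ a ℕ.+ b ≤ m ]
  [≤]-split a b m with a ℕ.≤? m
  ... | no a≰m = trans (*-zeroˡ [ b ≤ m ℕ.∸ a ]) (sym ([≤]-no (λ a+b≤m → a≰m (ℕP.m+n≤o⇒m≤o a a+b≤m))))
  ... | yes a≤m with b ℕ.≤? m ℕ.∸ a
  ...   | yes b≤m∸a = sym ([≤]-yes (subst (a ℕ.+ b ℕ.≤_) (ℕP.m+[n∸m]≡n a≤m) (ℕP.+-monoʳ-≤ a b≤m∸a)))
  ...   | no b≰m∸a = sym ([≤]-no (λ a+b≤m → b≰m∸a (subst (ℕ._≤ m ℕ.∸ a) (ℕP.m+n∸m≡n a b) (ℕP.∸-monoˡ-≤ a a+b≤m))))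

  [≡]-split : ∀ a b m → [ a ≤ m ] * [ b ≡ m ℕ.∸ a ] ≡ [ a ℕ.+ b ≡ m ]
  [≡]-split a b m with a ℕ.≤? m
  ... | no a≰m = trans (*-zeroˡ [ b ≡ m ℕ.∸ a ]) (sym ([≡]-no (λ a+b≡m → a≰m (subst (a ℕ.≤_) a+b≡m (ℕP.m≤m+n a b)))))
  ... | yes a≤m with b ℕ.≟ m ℕ.∸ a
  ...   | yes b≡m∸a = sym ([≡]-yes (trans (cong (a ℕ.+_) b≡m∸a) (ℕP.m+[n∸m]≡n a≤m)))
  ...   | no b≢m∸a = sym ([≡]-no (λ a+b≡m → b≢m∸a (trans (sym (ℕP.m+n∸m≡n a b)) (cong (ℕ._∸ a) a+b≡m))))

  Σ<-cong : ∀ n {f g : ℕ → ℚ} → (∀ i → f i ≡ g i) → Σ< n f ≡ Σ< n g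
  Σ<-cong zero    f≗g = refl
  Σ<-cong (suc n) f≗g = cong₂ _+_ (Σ<-cong n f≗g) (f≗g n)

  Σ<-cong-< : ∀ n {f g : ℕ → ℚ} → (∀ i → i ℕ.< n → f i ≡ g i) → Σ< n f ≡ Σ< n g
  Σ<-cong-< zero    f≗g = refl
  Σ<-cong-< (suc n) f≗g = cong₂ _+_ (Σ<-cong-< n (λ i i<n → f≗g i (ℕP.m<n⇒m<1+n i<n))) (f≗g n ℕP.≤-refl)

  Σ<-sucˡ : ∀ n (f : ℕ → ℚ) → Σ< (suc n) f ≡ f 0 + Σ< n (λ i → f (suc i))
  Σ<-sucˡ zero    f = trans (+-identityˡ (f 0)) (sym (+-identityʳ (f 0)))
  Σ<-sucˡ (suc n) f = trans (cong (_+ f (suc n)) (Σ<-sucˡ n f)) (+-assoc (f 0) _ _)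

  Σ<-zero : ∀ n {f : ℕ → ℚ} → (∀ i → f i ≡ 0ℚ) → Σ< n f ≡ 0ℚ
  Σ<-zero zero    f≗0 = refl
  Σ<-zero (suc n) f≗0 rewrite Σ<-zero n f≗0 | f≗0 n = refl

  Σ<-+ : ∀ n (f g : ℕ → ℚ) → Σ< n (λ i → f i + g i) ≡ Σ< n f + Σ< n g
  Σ<-+ zero    f g = refl
  Σ<-+ (suc n) f g rewrite Σ<-+ n f g =
    solve 4 (λ a b c d → (a :+ b) :+ (c :+ d) := (a :+ c) :+ (b :+ d)) refl (Σ< n f) (Σ< n g) (f n) (g n)

  Σ<-*ˡ : ∀ n c (f : ℕ → ℚ) → Σ< n (λ i → c * f i) ≡ c * Σ< n f
  Σ<-*ˡ zero    c f = sym (*-zeroʳ c)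
  Σ<-*ˡ (suc n) c f rewrite Σ<-*ˡ n c f = sym (*-distribˡ-+ c (Σ< n f) (f n))

  Σ<-comm : ∀ n m (h : ℕ → ℕ → ℚ) → Σ< n (λ i → Σ< m (h i)) ≡ Σ< m (λ j → Σ< n (λ i → h i j))
  Σ<-comm zero    m h = sym (Σ<-zero m (λ _ → refl))
  Σ<-comm (suc n) m h rewrite Σ<-comm n m h = sym (Σ<-+ m (λ j → Σ< n (λ i → h i j)) (h n))

  Σ<-vanishing : ∀ m d (f : ℕ → ℚ) → (∀ i → m ℕ.≤ i → f i ≡ 0ℚ) → Σ< (d ℕ.+ m) f ≡ Σ< m f
  Σ<-vanishing m zero    f f≗0 = refl
  Σ<-vanishing m (suc d) f f≗0
    rewrite Σ<-vanishing m d f f≗0 | f≗0 (d ℕ.+ m) (ℕP.m≤n+m m d) = +-identityʳ (Σ< m f)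

  Σ<-reverse : ∀ n (f : ℕ → ℚ) → Σ< (suc n) f ≡ Σ< (suc n) (λ i → f (n ℕ.∸ i))
  Σ<-reverse zero    f = refl
  Σ<-reverse (suc n) f = begin
    Σ< (suc n) f + f (suc n)                     ≡⟨ cong (_+ f (suc n)) (Σ<-reverse n f) ⟩
    Σ< (suc n) (λ i → f (n ℕ.∸ i)) + f (suc n)   ≡⟨ +-comm _ (f (suc n)) ⟩
    f (suc n) + Σ< (suc n) (λ i → f (n ℕ.∸ i))   ≡⟨ Σ<-sucˡ (suc n) (λ i → f (suc n ℕ.∸ i)) ⟨
    Σ< (suc (suc n)) (λ i → f (suc n ℕ.∸ i))     ∎
    where open ≡-Reasoning

  ΣFin-cong : ∀ n {f g : Fin n → ℚ} → (∀ i → f i ≡ g i) → ΣFin n f ≡ ΣFin n g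
  ΣFin-cong zero    f≗g = refl
  ΣFin-cong (suc n) f≗g = cong₂ _+_ (f≗g zero) (ΣFin-cong n (λ i → f≗g (suc i)))

  ΣFin-zero : ∀ n {f : Fin n → ℚ} → (∀ i → f i ≡ 0ℚ) → ΣFin n f ≡ 0ℚ
  ΣFin-zero zero    f≗0 = refl
  ΣFin-zero (suc n) f≗0 rewrite f≗0 zero | ΣFin-zero n (λ i → f≗0 (suc i)) = refl

  sumL-++ : ∀ xs ys → sumL (xs ++ ys) ≡ sumL xs + sumL ys
  sumL-++ []       ys = sym (+-identityˡ _)
  sumL-++ (x ∷ xs) ys rewrite sumL-++ xs ys = sym (+-assoc x (sumL xs) (sumL ys))

  sumL-concatMap : ∀ {A B : Set} (f : B → ℚ) (g : A → List B) xs →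
                   sumL (map f (concatMap g xs)) ≡ sumL (map (λ x → sumL (map f (g x))) xs)
  sumL-concatMap f g []       = refl
  sumL-concatMap f g (x ∷ xs) = begin
    sumL (map f (g x ++ concatMap g xs))                 ≡⟨ cong sumL (ListP.map-++ f (g x) (concatMap g xs)) ⟩
    sumL (map f (g x) ++ map f (concatMap g xs))         ≡⟨ sumL-++ (map f (g x)) _ ⟩
    sumL (map f (g x)) + sumL (map f (concatMap g xs))   ≡⟨ cong (sumL (map f (g x)) +_) (sumL-concatMap f g xs) ⟩
    sumL (map f (g x)) + sumL (map (λ y → sumL (map f (g y))) xs) ∎
    where open ≡-Reasoning

  sumL-applyUpTo : ∀ n (f : ℕ → ℚ) (g : ℕ → ℕ) → sumL (map f (applyUpTo g n)) ≡ Σ< n (λ i → f (g i))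
  sumL-applyUpTo zero    f g = refl
  sumL-applyUpTo (suc n) f g =
    trans (cong (f (g 0) +_) (sumL-applyUpTo n f (λ i → g (suc i)))) (sym (Σ<-sucˡ n (λ i → f (g i))))

  sumL-filter : ∀ {A : Set} {P : Pred A 0ℓ} (P? : Decidable P) (f : A → ℚ) xs →
                sumL (map f (filter P? xs)) ≡ sumL (map (λ x → if ⌊ P? x ⌋ then f x else 0ℚ) xs)
  sumL-filter P? f []       = refl
  sumL-filter P? f (x ∷ xs) with P? x
  ... | yes _ = cong (f x +_) (sumL-filter P? f xs)
  ... | no  _ = trans (sumL-filter P? f xs) (sym (+-identityˡ _))

  sumL-filter-cong : ∀ {A : Set} {P : Pred A 0ℓ} (P? : Decidable P) {f g : A → ℚ} →
                     (∀ x → P x → f x ≡ g x) → ∀ xs → sumL (map f (filter P? xs)) ≡ sumL (map g (filter P? xs))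
  sumL-filter-cong P? f≗g xs = cong sumL (ListP.map-cong-local (All.map (f≗g _) (all-filter P? xs)))

  -- Binomial and multinomial coefficients

  fact≡! : ∀ n → fact n ≡ n !
  fact≡! zero    = refl
  fact≡! (suc n) = cong (suc n ℕ.*_) (fact≡! n)

  0<* : ∀ {m n} → 0 ℕ.< m → 0 ℕ.< n → 0 ℕ.< m ℕ.* n
  0<* {suc m} {suc n} _ _ = s≤s z≤n

  0<fact : ∀ n → 0 ℕ.< fact n
  0<fact zero    = s≤s z≤n
  0<fact (suc n) = 0<* {suc n} (s≤s z≤n) (0<fact n)

  0<prodFact : ∀ {L} (t : Vec ℕ L) → 0 ℕ.< prodFact t
  0<prodFact []      = s≤s z≤n
  0<prodFact (x ∷ t) = 0<* (0<fact x) (0<prodFact t)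

  nCk*k!*[n∸k]!≡n! : ∀ {n k} → k ℕ.≤ n → (n C k) ℕ.* (k ! ℕ.* (n ℕ.∸ k) !) ≡ n !
  nCk*k!*[n∸k]!≡n! {n} {k} k≤n =
    trans (cong (ℕ._* (k ! ℕ.* (n ℕ.∸ k) !)) (nCk≡n!/k![n-k]! k≤n)) (m/n*n≡m (k![n∸k]!∣n! k≤n))
    where instance _ = k ℕP.!* (n ℕ.∸ k) !≢0

  [a+b]Cb*b!*a!≡[a+b]! : ∀ a b → ((a ℕ.+ b) C b) ℕ.* (fact b ℕ.* fact a) ≡ fact (a ℕ.+ b)
  [a+b]Cb*b!*a!≡[a+b]! a b = begin
    ((a ℕ.+ b) C b) ℕ.* (fact b ℕ.* fact a)               ≡⟨ cong₂ (λ u v → ((a ℕ.+ b) C b) ℕ.* (u ℕ.* v)) (fact≡! b) (fact≡! a) ⟩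
    ((a ℕ.+ b) C b) ℕ.* (b ! ℕ.* a !)                     ≡⟨ cong (λ m → ((a ℕ.+ b) C b) ℕ.* (b ! ℕ.* m !)) (ℕP.m+n∸n≡m a b) ⟨
    ((a ℕ.+ b) C b) ℕ.* (b ! ℕ.* (a ℕ.+ b ℕ.∸ b) !)       ≡⟨ nCk*k!*[n∸k]!≡n! (ℕP.m≤n+m b a) ⟩
    (a ℕ.+ b) !                                         ≡⟨ fact≡! (a ℕ.+ b) ⟨
    fact (a ℕ.+ b)                                      ∎
    where open ≡-Reasoning

  -- (k + t₀ + ⋯ + t_{L-1})! / (k! t₀! ⋯ t_{L-1}!)
  multinomial : ∀ {L} → ℕ → Vec ℕ L → ℕ
  multinomial k []      = 1
  multinomial k (x ∷ t) = ((k ℕ.+ x) C x) ℕ.* multinomial (k ℕ.+ x) t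

  multinomial-*-facts : ∀ {L} k (t : Vec ℕ L) → multinomial k t ℕ.* (fact k ℕ.* prodFact t) ≡ fact (k ℕ.+ sumV t)
  multinomial-*-facts k [] = trans (ℕP.*-identityˡ _) (trans (ℕP.*-identityʳ (fact k)) (cong fact (sym (ℕP.+-identityʳ k))))
  multinomial-*-facts k (x ∷ t) = begin
    B ℕ.* M ℕ.* (fact k ℕ.* (fact x ℕ.* P))   ≡⟨ ℕP.*-assoc B M _ ⟩
    B ℕ.* (M ℕ.* (fact k ℕ.* (fact x ℕ.* P))) ≡⟨ x∙yz≈y∙xz B M _ ⟩
    M ℕ.* (B ℕ.* (fact k ℕ.* (fact x ℕ.* P))) ≡⟨ cong (λ z → M ℕ.* (B ℕ.* z)) (x∙yz≈yx∙z (fact k) (fact x) P) ⟩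
    M ℕ.* (B ℕ.* (fact x ℕ.* fact k ℕ.* P))   ≡⟨ cong (M ℕ.*_) (ℕP.*-assoc B _ P) ⟨
    M ℕ.* (B ℕ.* (fact x ℕ.* fact k) ℕ.* P)   ≡⟨ cong (λ z → M ℕ.* (z ℕ.* P)) ([a+b]Cb*b!*a!≡[a+b]! k x) ⟩
    M ℕ.* (fact (k ℕ.+ x) ℕ.* P)              ≡⟨ multinomial-*-facts (k ℕ.+ x) t ⟩
    fact (k ℕ.+ x ℕ.+ sumV t)                 ≡⟨ cong fact (ℕP.+-assoc k x (sumV t)) ⟩
    fact (k ℕ.+ (x ℕ.+ sumV t))               ∎
    where
    open ≡-Reasoning
    B = (k ℕ.+ x) C x
    M = multinomial (k ℕ.+ x) t
    P = prodFact t

  multinom≡multinomial : ∀ {L} (t : Vec ℕ L) → multinom t ≡ ℕ→ℚ (multinomial 0 t)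
  multinom≡multinomial t = /ℕ-≡ (fact (sumV t)) (multinomial 0 t) (0<prodFact t) (s≤s z≤n) (begin
    fact (sumV t) ℕ.* 1                       ≡⟨ ℕP.*-identityʳ _ ⟩
    fact (sumV t)                             ≡⟨ multinomial-*-facts 0 t ⟨
    multinomial 0 t ℕ.* (1 ℕ.* prodFact t)    ≡⟨ cong (multinomial 0 t ℕ.*_) (ℕP.*-identityˡ (prodFact t)) ⟩
    multinomial 0 t ℕ.* prodFact t            ∎)
    where open ≡-Reasoning

  binomℚ : ℕ → ℕ → ℚ
  binomℚ n k = ℕ→ℚ (n C k)

  binomℚ-pascal : ∀ n k → binomℚ (suc n) (suc k) ≡ binomℚ n k + binomℚ n (suc k)
  binomℚ-pascal n k = trans (cong ℕ→ℚ (sym (nCk+nC[k+1]≡[n+1]C[k+1] n k))) (ℕ→ℚ-+ (n C k) (n C suc k))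

  -- Toeplitz–Hessenberg determinants

  hessenberg : (ℕ → ℚ) → ℕ → ℕ → ℚ
  hessenberg a i       zero          = a (suc i)
  hessenberg a zero    (suc zero)    = 1ℚ
  hessenberg a zero    (suc (suc j)) = 0ℚ
  hessenberg a (suc i) (suc j)       = hessenberg a i j

  hessenberg-≤ : ∀ a {i j} → j ℕ.≤ i → hessenberg a i j ≡ a (suc (i ℕ.∸ j))
  hessenberg-≤ a {i}     {zero}  z≤n       = refl
  hessenberg-≤ a {suc i} {suc j} (s≤s j≤i) = hessenberg-≤ a j≤i

  hessenberg-suc : ∀ a i → hessenberg a i (suc i) ≡ 1ℚ
  hessenberg-suc a zero    = refl
  hessenberg-suc a (suc i) = hessenberg-suc a i

  hessenberg-> : ∀ a {i j} → ¬ j ℕ.≤ i → j ≢ suc i → hessenberg a i j ≡ 0ℚ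
  hessenberg-> a {i}     {zero}        j≰i _     = ⊥-elim (j≰i z≤n)
  hessenberg-> a {zero}  {suc zero}    _   j≢1   = ⊥-elim (j≢1 refl)
  hessenberg-> a {zero}  {suc (suc j)} _   _     = refl
  hessenberg-> a {suc i} {suc j}       j≰i j≢i+1 = hessenberg-> a (λ j≤i → j≰i (s≤s j≤i)) (λ j≡i+1 → j≢i+1 (cong suc j≡i+1))

  hessenbergDet : (ℕ → ℚ) → ℕ → ℚ
  hessenbergDet a n = det n (λ i j → hessenberg a (toℕ i) (toℕ j))

  det-cong : ∀ n {M M′ : Fin n → Fin n → ℚ} → (∀ i j → M i j ≡ M′ i j) → det n M ≡ det n M′
  det-cong zero    M≗M′ = refl
  det-cong (suc n) M≗M′ = ΣFin-cong (suc n) (λ j →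
    cong₂ (λ u v → sgn (toℕ j) * (u * v)) (M≗M′ zero j) (det-cong n (λ i k → M≗M′ (suc i) (punchIn j k))))

  module _ (a : ℕ → ℚ) where

    shiftedHessenberg : ℕ → (n : ℕ) → Fin (suc n) → Fin (suc n) → ℚ
    shiftedHessenberg k n i zero    = a (k ℕ.+ toℕ i)
    shiftedHessenberg k n i (suc j) = hessenberg a (toℕ i) (suc (toℕ j))

    shiftedDet : ℕ → ℕ → ℚ
    shiftedDet k n = det (suc n) (shiftedHessenberg k n)

    hessenbergDet-suc≡shiftedDet : ∀ n → hessenbergDet a (suc n) ≡ shiftedDet 1 n
    hessenbergDet-suc≡shiftedDet n =
      det-cong (suc n) {λ i j → hessenberg a (toℕ i) (toℕ j)} {shiftedHessenberg 1 n} λ { i zero → refl ; i (suc j) → refl }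

    -- Laplace expansion along the first row, whose entries are a k, 1, 0, …, 0.
    shiftedDet-suc : ∀ k n → shiftedDet k (suc n) ≡ a k * hessenbergDet a (suc n) + (- 1ℚ) * shiftedDet (suc k) n
    shiftedDet-suc k n = begin
      sgn 0 * (a (k ℕ.+ 0) * hessenbergDet a (suc n))
        + (sgn 1 * (1ℚ * det (suc n) (minor (suc zero)))
        + ΣFin n (λ j → sgn (suc (suc (toℕ j))) * (0ℚ * det (suc n) (minor (suc (suc j))))))
          ≡⟨ cong₂ (λ u v → sgn 0 * (a u * hessenbergDet a (suc n)) + (sgn 1 * (1ℚ * det (suc n) (minor (suc zero))) + v))
                   (ℕP.+-identityʳ k) (ΣFin-zero n (λ j → trans (cong (sgn (suc (suc (toℕ j))) *_) (*-zeroˡ (det (suc n) (minor (suc (suc j))))))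
                                                               (*-zeroʳ (sgn (suc (suc (toℕ j))))))) ⟩
      sgn 0 * (a k * hessenbergDet a (suc n)) + (sgn 1 * (1ℚ * det (suc n) (minor (suc zero))) + 0ℚ)
          ≡⟨ cong (λ u → sgn 0 * (a k * hessenbergDet a (suc n)) + (sgn 1 * (1ℚ * u) + 0ℚ)) minor₁ ⟩
      sgn 0 * (a k * hessenbergDet a (suc n)) + (sgn 1 * (1ℚ * shiftedDet (suc k) n) + 0ℚ)
          ≡⟨ solve 2 (λ x y → con 1ℚ :* x :+ ((con (- 1ℚ) :* con 1ℚ) :* (con 1ℚ :* y) :+ con 0ℚ) := x :+ con (- 1ℚ) :* y)
                   refl (a k * hessenbergDet a (suc n)) (shiftedDet (suc k) n) ⟩
      a k * hessenbergDet a (suc n) + (- 1ℚ) * shiftedDet (suc k) n ∎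
      where
      open ≡-Reasoning
      minor : Fin (suc (suc n)) → Fin (suc n) → Fin (suc n) → ℚ
      minor j i l = shiftedHessenberg k (suc n) (suc i) (punchIn j l)
      minor₁ : det (suc n) (minor (suc zero)) ≡ shiftedDet (suc k) n
      minor₁ = det-cong (suc n) {minor (suc zero)} {shiftedHessenberg (suc k) n}
                 λ { i zero → cong a (ℕP.+-suc k (toℕ i)) ; i (suc l) → refl }

    shiftedDet≡Σ : ∀ n k → shiftedDet k n ≡ Σ< (suc n) (λ m → sgn m * (a (k ℕ.+ m) * hessenbergDet a (n ℕ.∸ m)))
    shiftedDet≡Σ zero    k = +-comm (sgn 0 * (a (k ℕ.+ 0) * 1ℚ)) 0ℚ
    shiftedDet≡Σ (suc n) k = begin
      shiftedDet k (suc n)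
        ≡⟨ shiftedDet-suc k n ⟩
      a k * hessenbergDet a (suc n) + (- 1ℚ) * shiftedDet (suc k) n
        ≡⟨ cong₂ _+_ head (cong ((- 1ℚ) *_) (shiftedDet≡Σ n (suc k))) ⟩
      term 0 + (- 1ℚ) * Σ< (suc n) (λ m → sgn m * (a (suc k ℕ.+ m) * hessenbergDet a (n ℕ.∸ m)))
        ≡⟨ cong (term 0 +_) (sym (Σ<-*ˡ (suc n) (- 1ℚ) _)) ⟩
      term 0 + Σ< (suc n) (λ m → (- 1ℚ) * (sgn m * (a (suc k ℕ.+ m) * hessenbergDet a (n ℕ.∸ m))))
        ≡⟨ cong (term 0 +_) (Σ<-cong (suc n) tail) ⟩
      term 0 + Σ< (suc n) (λ m → term (suc m))
        ≡⟨ Σ<-sucˡ (suc n) term ⟨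
      Σ< (suc (suc n)) term ∎
      where
      open ≡-Reasoning
      term : ℕ → ℚ
      term m = sgn m * (a (k ℕ.+ m) * hessenbergDet a (suc n ℕ.∸ m))
      head : a k * hessenbergDet a (suc n) ≡ term 0
      head = trans (cong (λ z → a z * hessenbergDet a (suc n)) (sym (ℕP.+-identityʳ k))) (sym (*-identityˡ _))
      tail : ∀ m → (- 1ℚ) * (sgn m * (a (suc k ℕ.+ m) * hessenbergDet a (n ℕ.∸ m))) ≡ term (suc m)
      tail m = trans (sym (*-assoc (- 1ℚ) (sgn m) _)) (cong (λ z → sgn (suc m) * (a z * hessenbergDet a (n ℕ.∸ m))) (sym (ℕP.+-suc k m)))

    hessenbergDet-suc : ∀ n → hessenbergDet a (suc n) ≡ Σ< (suc n) (λ m → sgn m * (a (suc m) * hessenbergDet a (n ℕ.∸ m)))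
    hessenbergDet-suc n = trans (hessenbergDet-suc≡shiftedDet n) (shiftedDet≡Σ n 1)

  _IsConvolutionInverseOf_ : (ℕ → ℚ) → (ℕ → ℚ) → Set
  b IsConvolutionInverseOf a = ∀ m → Σ< (suc m) (λ k → b k * a (m ℕ.∸ k)) ≡ [ m ≡ 0 ]

  module _ (a b : ℕ → ℚ) (b₀≡1 : b 0 ≡ 1ℚ) (b⁻¹≡a : b IsConvolutionInverseOf a) where

    convolutionInverse-head : a 0 ≡ 1ℚ
    convolutionInverse-head = begin
      a 0               ≡⟨ *-identityˡ (a 0) ⟨
      1ℚ * a 0          ≡⟨ cong (_* a 0) b₀≡1 ⟨
      b 0 * a 0         ≡⟨ +-identityˡ (b 0 * a 0) ⟨
      0ℚ + b 0 * a 0    ≡⟨ b⁻¹≡a 0 ⟩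
      1ℚ                ∎
      where open ≡-Reasoning

    convolutionInverse-rec : ∀ m → a (suc m) ≡ Σ< (suc m) (λ j → (- b (suc j)) * a (m ℕ.∸ j))
    convolutionInverse-rec m = begin
      a (suc m)                                      ≡⟨ *-identityˡ (a (suc m)) ⟨
      1ℚ * a (suc m)                                 ≡⟨ cong (_* a (suc m)) b₀≡1 ⟨
      b 0 * a (suc m)                                ≡⟨ inverseˡ-unique _ _ head+tail≡0 ⟩
      - Σ< (suc m) f                                 ≡⟨ solve 1 (λ x → :- x := con (- 1ℚ) :* x) refl (Σ< (suc m) f) ⟩
      (- 1ℚ) * Σ< (suc m) f                          ≡⟨ Σ<-*ˡ (suc m) (- 1ℚ) f ⟨
      Σ< (suc m) (λ j → (- 1ℚ) * f j)                ≡⟨ Σ<-cong (suc m) (λ j → solve 2 (λ x y → con (- 1ℚ) :* (x :* y) := (:- x) :* y) refl (b (suc j)) (a (m ℕ.∸ j))) ⟩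
      Σ< (suc m) (λ j → (- b (suc j)) * a (m ℕ.∸ j)) ∎
      where
      open ≡-Reasoning
      f : ℕ → ℚ
      f j = b (suc j) * a (m ℕ.∸ j)
      head+tail≡0 : b 0 * a (suc m) + Σ< (suc m) f ≡ 0ℚ
      head+tail≡0 = trans (sym (Σ<-sucˡ (suc m) (λ k → b k * a (suc m ℕ.∸ k)))) (b⁻¹≡a (suc m))

    hessenbergDet≡sgn*inverse : ∀ n → hessenbergDet a n ≡ sgn n * b n
    hessenbergDet≡sgn*inverse = <-rec _ step
      where
      step : ∀ n → (∀ {m} → m ℕ.< n → hessenbergDet a m ≡ sgn m * b m) → hessenbergDet a n ≡ sgn n * b n
      step zero    _  = sym (trans (*-identityˡ (b 0)) b₀≡1)
      step (suc n) ih = begin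
        hessenbergDet a (suc n)
          ≡⟨ hessenbergDet-suc a n ⟩
        Σ< (suc n) (λ m → sgn m * (a (suc m) * hessenbergDet a (n ℕ.∸ m)))
          ≡⟨ Σ<-cong-< (suc n) term ⟩
        Σ< (suc n) (λ m → sgn n * (b (n ℕ.∸ m) * a (suc n ℕ.∸ (n ℕ.∸ m))))
          ≡⟨ Σ<-*ˡ (suc n) (sgn n) _ ⟩
        sgn n * Σ< (suc n) (λ m → b (n ℕ.∸ m) * a (suc n ℕ.∸ (n ℕ.∸ m)))
          ≡⟨ cong (sgn n *_) (Σ<-reverse n (λ k → b k * a (suc n ℕ.∸ k))) ⟨
        sgn n * Σ< (suc n) (λ k → b k * a (suc n ℕ.∸ k))
          ≡⟨ cong (sgn n *_) lowerTerms ⟩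
        sgn n * (- b (suc n))
          ≡⟨ solve 2 (λ s x → s :* (:- x) := (con (- 1ℚ) :* s) :* x) refl (sgn n) (b (suc n)) ⟩
        sgn (suc n) * b (suc n) ∎
        where
        open ≡-Reasoning
        term : ∀ m → m ℕ.< suc n → sgn m * (a (suc m) * hessenbergDet a (n ℕ.∸ m)) ≡ sgn n * (b (n ℕ.∸ m) * a (suc n ℕ.∸ (n ℕ.∸ m)))
        term m (s≤s m≤n) = begin
          sgn m * (a (suc m) * hessenbergDet a (n ℕ.∸ m))
            ≡⟨ cong (λ d → sgn m * (a (suc m) * d)) (ih (s≤s (ℕP.m∸n≤m n m))) ⟩
          sgn m * (a (suc m) * (sgn (n ℕ.∸ m) * b (n ℕ.∸ m)))
            ≡⟨ *-solve 4 (λ s x t y → s ⊕ (x ⊕ (t ⊕ y)) ⊜ (s ⊕ t) ⊕ (y ⊕ x)) refl (sgn m) (a (suc m)) (sgn (n ℕ.∸ m)) (b (n ℕ.∸ m)) ⟩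
          (sgn m * sgn (n ℕ.∸ m)) * (b (n ℕ.∸ m) * a (suc m))
            ≡⟨ cong₂ (λ s k → s * (b (n ℕ.∸ m) * a k)) (sgn-∸ m≤n) (sym suc[n∸[n∸m]]) ⟩
          sgn n * (b (n ℕ.∸ m) * a (suc n ℕ.∸ (n ℕ.∸ m))) ∎
          where
          suc[n∸[n∸m]] : suc n ℕ.∸ (n ℕ.∸ m) ≡ suc m
          suc[n∸[n∸m]] = trans (ℕP.+-∸-assoc 1 (ℕP.m∸n≤m n m)) (cong suc (ℕP.m∸[m∸n]≡n m≤n))
        lowerTerms : Σ< (suc n) (λ k → b k * a (suc n ℕ.∸ k)) ≡ - b (suc n)
        lowerTerms = inverseˡ-unique _ (b (suc n)) (begin
          Σ< (suc n) (λ k → b k * a (suc n ℕ.∸ k)) + b (suc n)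
            ≡⟨ cong (λ x → Σ< (suc n) (λ k → b k * a (suc n ℕ.∸ k)) + x) lastTerm ⟩
          Σ< (suc (suc n)) (λ k → b k * a (suc n ℕ.∸ k))
            ≡⟨ b⁻¹≡a (suc n) ⟩
          0ℚ ∎)
          where
          lastTerm : b (suc n) ≡ b (suc n) * a (n ℕ.∸ n)
          lastTerm = begin
            b (suc n)            ≡⟨ *-identityʳ _ ⟨
            b (suc n) * 1ℚ       ≡⟨ cong (b (suc n) *_) convolutionInverse-head ⟨
            b (suc n) * a 0      ≡⟨ cong (λ k → b (suc n) * a k) (ℕP.n∸n≡0 n) ⟨
            b (suc n) * a (n ℕ.∸ n) ∎

  -- Multinomial sums over a box

  monomial : (ℕ → ℚ) → ∀ {L} → ℕ → Vec ℕ L → ℚ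
  monomial g i []      = 1ℚ
  monomial g i (x ∷ t) = g i ^ℚ x * monomial g (suc i) t

  boxSum : ℕ → (L : ℕ) → (Vec ℕ L → ℚ) → ℚ
  boxSum B zero    f = f []
  boxSum B (suc L) f = Σ< (suc B) (λ x → boxSum B L (λ t → f (x ∷ t)))

  boxSum-cong : ∀ B L {f g : Vec ℕ L → ℚ} → (∀ t → f t ≡ g t) → boxSum B L f ≡ boxSum B L g
  boxSum-cong B zero    f≗g = f≗g []
  boxSum-cong B (suc L) f≗g = Σ<-cong (suc B) (λ x → boxSum-cong B L (λ t → f≗g (x ∷ t)))

  boxSum-*ˡ : ∀ B L c (f : Vec ℕ L → ℚ) → boxSum B L (λ t → c * f t) ≡ c * boxSum B L f
  boxSum-*ˡ B zero    c f = refl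
  boxSum-*ˡ B (suc L) c f = trans (Σ<-cong (suc B) (λ x → boxSum-*ˡ B L c (λ t → f (x ∷ t)))) (Σ<-*ˡ (suc B) c _)

  sumL-allVecs : ∀ B L (f : Vec ℕ L → ℚ) → sumL (map f (allVecs B L)) ≡ boxSum B L f
  sumL-allVecs B zero    f = +-identityʳ (f [])
  sumL-allVecs B (suc L) f = begin
    sumL (map f (concatMap (λ x → map (x ∷_) (allVecs B L)) (upTo (suc B))))
      ≡⟨ sumL-concatMap f (λ x → map (x ∷_) (allVecs B L)) (upTo (suc B)) ⟩
    sumL (map (λ x → sumL (map f (map (x ∷_) (allVecs B L)))) (upTo (suc B)))
      ≡⟨ sumL-applyUpTo (suc B) _ (λ x → x) ⟩
    Σ< (suc B) (λ x → sumL (map f (map (x ∷_) (allVecs B L))))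
      ≡⟨ Σ<-cong (suc B) (λ x → trans (cong sumL (sym (ListP.map-∘ (allVecs B L)))) (sumL-allVecs B L (λ t → f (x ∷ t)))) ⟩
    boxSum B (suc L) f ∎
    where open ≡-Reasoning

  module _ (B : ℕ) (g : ℕ → ℚ) where

    -- The sum over t ∈ {0, …, B}^L with Σ_l (i + l) t_l = m of multinomial k t * monomial g i t,
    -- by recursion on the first coordinate of t.
    weightedSum : (L i m k : ℕ) → ℚ
    weightedSum zero    i m k = [ m ≤ 0 ]
    weightedSum (suc L) i m k = Σ< (suc B) (λ x →
      [ i ℕ.* x ≤ m ] * (g i ^ℚ x * (binomℚ (k ℕ.+ x) x * weightedSum L (suc i) (m ℕ.∸ i ℕ.* x) (k ℕ.+ x))))

    boxSum≡weightedSum : ∀ L i m k →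
      boxSum B L (λ t → [ weighted i t ≡ m ] * (ℕ→ℚ (multinomial k t) * monomial g i t)) ≡ weightedSum L i m k
    boxSum≡weightedSum zero    i zero    k = refl
    boxSum≡weightedSum zero    i (suc m) k = refl
    boxSum≡weightedSum (suc L) i m k = Σ<-cong (suc B) λ x → begin
      boxSum B L (λ t → [ i ℕ.* x ℕ.+ weighted (suc i) t ≡ m ] * (ℕ→ℚ (multinomial k (x ∷ t)) * monomial g i (x ∷ t)))
        ≡⟨ boxSum-cong B L (factor x) ⟩
      boxSum B L (λ t → c x * ([ weighted (suc i) t ≡ m ℕ.∸ i ℕ.* x ] * (ℕ→ℚ (multinomial (k ℕ.+ x) t) * monomial g (suc i) t)))
        ≡⟨ boxSum-*ˡ B L (c x) _ ⟩
      c x * boxSum B L (λ t → [ weighted (suc i) t ≡ m ℕ.∸ i ℕ.* x ] * (ℕ→ℚ (multinomial (k ℕ.+ x) t) * monomial g (suc i) t))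
        ≡⟨ cong (c x *_) (boxSum≡weightedSum L (suc i) (m ℕ.∸ i ℕ.* x) (k ℕ.+ x)) ⟩
      c x * weightedSum L (suc i) (m ℕ.∸ i ℕ.* x) (k ℕ.+ x)
        ≡⟨ *-solve 4 (λ e p b w → (e ⊕ (p ⊕ b)) ⊕ w ⊜ e ⊕ (p ⊕ (b ⊕ w))) refl
             [ i ℕ.* x ≤ m ] (g i ^ℚ x) (binomℚ (k ℕ.+ x) x) (weightedSum L (suc i) (m ℕ.∸ i ℕ.* x) (k ℕ.+ x)) ⟩
      [ i ℕ.* x ≤ m ] * (g i ^ℚ x * (binomℚ (k ℕ.+ x) x * weightedSum L (suc i) (m ℕ.∸ i ℕ.* x) (k ℕ.+ x))) ∎
      where
      open ≡-Reasoning
      c : ℕ → ℚ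
      c x = [ i ℕ.* x ≤ m ] * (g i ^ℚ x * binomℚ (k ℕ.+ x) x)
      factor : ∀ x t → [ i ℕ.* x ℕ.+ weighted (suc i) t ≡ m ] * (ℕ→ℚ (multinomial k (x ∷ t)) * monomial g i (x ∷ t))
                     ≡ c x * ([ weighted (suc i) t ≡ m ℕ.∸ i ℕ.* x ] * (ℕ→ℚ (multinomial (k ℕ.+ x) t) * monomial g (suc i) t))
      factor x t = begin
        [ i ℕ.* x ℕ.+ w ≡ m ] * (ℕ→ℚ (Bin ℕ.* M) * (p * P))
          ≡⟨ cong₂ (λ u v → u * (v * (p * P))) (sym ([≡]-split (i ℕ.* x) w m)) (ℕ→ℚ-* Bin M) ⟩
        ([ i ℕ.* x ≤ m ] * [ w ≡ m ℕ.∸ i ℕ.* x ]) * ((ℕ→ℚ Bin * ℕ→ℚ M) * (p * P))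
          ≡⟨ *-solve 6 (λ e e′ b M p P → (e ⊕ e′) ⊕ ((b ⊕ M) ⊕ (p ⊕ P)) ⊜ (e ⊕ (p ⊕ b)) ⊕ (e′ ⊕ (M ⊕ P))) refl
               [ i ℕ.* x ≤ m ] [ w ≡ m ℕ.∸ i ℕ.* x ] (ℕ→ℚ Bin) (ℕ→ℚ M) p P ⟩
        c x * ([ w ≡ m ℕ.∸ i ℕ.* x ] * (ℕ→ℚ M * P)) ∎
        where
        w = weighted (suc i) t
        Bin = (k ℕ.+ x) C x
        M = multinomial (k ℕ.+ x) t
        p = g i ^ℚ x
        P = monomial g (suc i) t

    weightedSumPred : (L i m k : ℕ) → ℚ
    weightedSumPred L i m zero    = 0ℚ
    weightedSumPred L i m (suc k) = weightedSum L i m k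

    partTerm : (L i m k j : ℕ) → ℚ
    partTerm L i m k j = [ i ℕ.+ j ≤ m ] * (g (i ℕ.+ j) * weightedSum L i (m ℕ.∸ (i ℕ.+ j)) k)

    shiftedTerm : (L i m k x : ℕ) → ℚ
    shiftedTerm L i m k x =
      [ i ℕ.* suc x ≤ m ] * (g i ^ℚ suc x * (binomℚ (k ℕ.+ x) x * weightedSum L (suc i) (m ℕ.∸ i ℕ.* suc x) (k ℕ.+ x)))

    -- The term x = B of the right-hand side vanishes because i (B + 1) > B ≥ m.
    Σ-shiftedTerm : ∀ L i m k → 1 ℕ.≤ i → m ℕ.≤ B → Σ< B (shiftedTerm L i m k) ≡ partTerm (suc L) i m k 0
    Σ-shiftedTerm L i m k 1≤i m≤B = begin
      Σ< B (shiftedTerm L i m k)                   ≡⟨ Σ<-cong B factor ⟩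
      Σ< B (λ x → [ i ≤ m ] * (g i * R x))          ≡⟨ +-identityʳ _ ⟨
      Σ< B (λ x → [ i ≤ m ] * (g i * R x)) + 0ℚ     ≡⟨ cong (Σ< B (λ x → [ i ≤ m ] * (g i * R x)) +_) lastTerm ⟨
      Σ< (suc B) (λ x → [ i ≤ m ] * (g i * R x))    ≡⟨ Σ<-*ˡ (suc B) [ i ≤ m ] _ ⟩
      [ i ≤ m ] * Σ< (suc B) (λ x → g i * R x)      ≡⟨ cong ([ i ≤ m ] *_) (Σ<-*ˡ (suc B) (g i) R) ⟩
      [ i ≤ m ] * (g i * Σ< (suc B) R)              ≡⟨ cong (λ n → [ n ≤ m ] * (g n * weightedSum (suc L) i (m ℕ.∸ n) k)) (ℕP.+-identityʳ i) ⟨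
      partTerm (suc L) i m k 0                      ∎
      where
      open ≡-Reasoning
      R : ℕ → ℚ
      R x = [ i ℕ.* x ≤ m ℕ.∸ i ] * (g i ^ℚ x * (binomℚ (k ℕ.+ x) x * weightedSum L (suc i) (m ℕ.∸ i ℕ.∸ i ℕ.* x) (k ℕ.+ x)))
      factor : ∀ x → shiftedTerm L i m k x ≡ [ i ≤ m ] * (g i * R x)
      factor x = begin
        [ i ℕ.* suc x ≤ m ] * (g i ^ℚ suc x * (b * weightedSum L (suc i) (m ℕ.∸ i ℕ.* suc x) (k ℕ.+ x)))
          ≡⟨ cong₂ (λ e n → e * (g i ^ℚ suc x * (b * weightedSum L (suc i) n (k ℕ.+ x)))) bracket index ⟩
        ([ i ≤ m ] * [ i ℕ.* x ≤ m ℕ.∸ i ]) * ((g i * g i ^ℚ x) * (b * weightedSum L (suc i) (m ℕ.∸ i ℕ.∸ i ℕ.* x) (k ℕ.+ x)))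
          ≡⟨ *-solve 5 (λ e e′ y p z → (e ⊕ e′) ⊕ ((y ⊕ p) ⊕ z) ⊜ e ⊕ (y ⊕ (e′ ⊕ (p ⊕ z)))) refl
               [ i ≤ m ] [ i ℕ.* x ≤ m ℕ.∸ i ] (g i) (g i ^ℚ x) (b * weightedSum L (suc i) (m ℕ.∸ i ℕ.∸ i ℕ.* x) (k ℕ.+ x)) ⟩
        [ i ≤ m ] * (g i * R x) ∎
        where
        b = binomℚ (k ℕ.+ x) x
        bracket : [ i ℕ.* suc x ≤ m ] ≡ [ i ≤ m ] * [ i ℕ.* x ≤ m ℕ.∸ i ]
        bracket = trans (cong [_≤ m ] (ℕP.*-suc i x)) (sym ([≤]-split i (i ℕ.* x) m))
        index : m ℕ.∸ i ℕ.* suc x ≡ m ℕ.∸ i ℕ.∸ i ℕ.* x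
        index = trans (cong (m ℕ.∸_) (ℕP.*-suc i x)) (sym (ℕP.∸-+-assoc m i (i ℕ.* x)))
      m<i+i*B : m ℕ.< i ℕ.+ i ℕ.* B
      m<i+i*B = ℕP.≤-<-trans m≤B (ℕP.<-≤-trans (ℕP.n<1+n B) (ℕP.+-mono-≤ 1≤i (ℕP.m≤n*m B i {{ℕ.>-nonZero 1≤i}})))
      lastTerm : [ i ≤ m ] * (g i * R B) ≡ 0ℚ
      lastTerm = begin
        [ i ≤ m ] * (g i * R B)
          ≡⟨ *-solve 4 (λ e y e′ z → e ⊕ (y ⊕ (e′ ⊕ z)) ⊜ (e ⊕ e′) ⊕ (y ⊕ z)) refl [ i ≤ m ] (g i) [ i ℕ.* B ≤ m ℕ.∸ i ] Z ⟩
        ([ i ≤ m ] * [ i ℕ.* B ≤ m ℕ.∸ i ]) * (g i * Z)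
          ≡⟨ cong (_* (g i * Z)) (trans ([≤]-split i (i ℕ.* B) m) ([≤]-no (ℕP.<⇒≱ m<i+i*B))) ⟩
        0ℚ * (g i * Z)
          ≡⟨ *-zeroˡ (g i * Z) ⟩
        0ℚ ∎
        where
        Z = g i ^ℚ B * (binomℚ (k ℕ.+ B) B * weightedSum L (suc i) (m ℕ.∸ i ℕ.∸ i ℕ.* B) (k ℕ.+ B))

    Σ-predTerms : ∀ L i m k → 1 ℕ.≤ i → m ℕ.≤ B →
      Σ< (suc B) (λ x → [ i ℕ.* x ≤ m ] * (g i ^ℚ x * (binomℚ (k ℕ.+ x) x * weightedSumPred L (suc i) (m ℕ.∸ i ℕ.* x) (k ℕ.+ x))))
        ≡ weightedSumPred (suc L) i m k + partTerm (suc L) i m k 0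
    Σ-predTerms L i m zero 1≤i m≤B = begin
      Σ< (suc B) T                      ≡⟨ Σ<-sucˡ B T ⟩
      T 0 + Σ< B (λ x → T (suc x))      ≡⟨ cong₂ _+_ T₀≡0 (Σ<-cong B T-suc) ⟩
      0ℚ + Σ< B (shiftedTerm L i m 0)   ≡⟨ cong (0ℚ +_) (Σ-shiftedTerm L i m 0 1≤i m≤B) ⟩
      0ℚ + partTerm (suc L) i m 0 0     ∎
      where
      open ≡-Reasoning
      T : ℕ → ℚ
      T x = [ i ℕ.* x ≤ m ] * (g i ^ℚ x * (binomℚ x x * weightedSumPred L (suc i) (m ℕ.∸ i ℕ.* x) x))
      T₀≡0 : T 0 ≡ 0ℚ
      T₀≡0 = solve 3 (λ e p b → e :* (p :* (b :* con 0ℚ)) := con 0ℚ) refl [ i ℕ.* 0 ≤ m ] 1ℚ (binomℚ 0 0)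
      T-suc : ∀ x → T (suc x) ≡ shiftedTerm L i m 0 x
      T-suc x = cong (λ b → [ i ℕ.* suc x ≤ m ] * (g i ^ℚ suc x * (ℕ→ℚ b * weightedSum L (suc i) (m ℕ.∸ i ℕ.* suc x) x)))
                     (trans (nCn≡1 (suc x)) (sym (nCn≡1 x)))
    Σ-predTerms L i m (suc k) 1≤i m≤B = begin
      Σ< (suc B) T                                  ≡⟨ Σ<-cong (suc B) split ⟩
      Σ< (suc B) (λ x → U x + P x)                  ≡⟨ Σ<-+ (suc B) U P ⟩
      weightedSum (suc L) i m k + Σ< (suc B) P      ≡⟨ cong (weightedSum (suc L) i m k +_) (Σ<-sucˡ B P) ⟩
      weightedSum (suc L) i m k + (0ℚ + Σ< B (shiftedTerm L i m (suc k)))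
        ≡⟨ cong (λ z → weightedSum (suc L) i m k + z) (trans (+-identityˡ _) (Σ-shiftedTerm L i m (suc k) 1≤i m≤B)) ⟩
      weightedSum (suc L) i m k + partTerm (suc L) i m (suc k) 0 ∎
      where
      open ≡-Reasoning
      T U : ℕ → ℚ
      T x = [ i ℕ.* x ≤ m ] * (g i ^ℚ x * (binomℚ (suc k ℕ.+ x) x * weightedSum L (suc i) (m ℕ.∸ i ℕ.* x) (k ℕ.+ x)))
      U x = [ i ℕ.* x ≤ m ] * (g i ^ℚ x * (binomℚ (k ℕ.+ x) x * weightedSum L (suc i) (m ℕ.∸ i ℕ.* x) (k ℕ.+ x)))
      P : ℕ → ℚ
      P zero    = 0ℚ
      P (suc x) = shiftedTerm L i m (suc k) x
      split : ∀ x → T x ≡ U x + P x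
      split zero    = sym (+-identityʳ (U 0))
      split (suc x) = begin
        e * (p * (binomℚ (suc (k ℕ.+ suc x)) (suc x) * w))
          ≡⟨ cong (λ b → e * (p * (b * w))) (binomℚ-pascal (k ℕ.+ suc x) x) ⟩
        e * (p * ((binomℚ (k ℕ.+ suc x) x + binomℚ (k ℕ.+ suc x) (suc x)) * w))
          ≡⟨ solve 5 (λ e p b b′ w → e :* (p :* ((b :+ b′) :* w)) := e :* (p :* (b′ :* w)) :+ e :* (p :* (b :* w))) refl
               e p (binomℚ (k ℕ.+ suc x) x) (binomℚ (k ℕ.+ suc x) (suc x)) w ⟩
        U (suc x) + e * (p * (binomℚ (k ℕ.+ suc x) x * w))
          ≡⟨ cong (λ n → U (suc x) + e * (p * (binomℚ n x * weightedSum L (suc i) (m ℕ.∸ i ℕ.* suc x) n))) (ℕP.+-suc k x) ⟩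
        U (suc x) + P (suc x) ∎
        where
        e = [ i ℕ.* suc x ≤ m ]
        p = g i ^ℚ suc x
        w = weightedSum L (suc i) (m ℕ.∸ i ℕ.* suc x) (k ℕ.+ suc x)

    Σ-partTerms : ∀ L i m k →
      Σ< (suc B) (λ x → [ i ℕ.* x ≤ m ] * (g i ^ℚ x * (binomℚ (k ℕ.+ x) x * Σ< L (partTerm L (suc i) (m ℕ.∸ i ℕ.* x) (k ℕ.+ x)))))
        ≡ Σ< L (λ j → partTerm (suc L) i m k (suc j))
    Σ-partTerms L i m k = begin
      Σ< (suc B) (λ x → e x * (p x * (b x * Σ< L (V x))))
        ≡⟨ Σ<-cong (suc B) pushIn ⟩
      Σ< (suc B) (λ x → Σ< L (λ j → e x * (p x * (b x * V x j))))
        ≡⟨ Σ<-comm (suc B) L (λ x j → e x * (p x * (b x * V x j))) ⟩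
      Σ< L (λ j → Σ< (suc B) (λ x → e x * (p x * (b x * V x j))))
        ≡⟨ Σ<-cong L perPart ⟩
      Σ< L (λ j → partTerm (suc L) i m k (suc j)) ∎
      where
      open ≡-Reasoning
      e p b : ℕ → ℚ
      e x = [ i ℕ.* x ≤ m ]
      p x = g i ^ℚ x
      b x = binomℚ (k ℕ.+ x) x
      V : ℕ → ℕ → ℚ
      V x = partTerm L (suc i) (m ℕ.∸ i ℕ.* x) (k ℕ.+ x)
      pushIn : ∀ x → e x * (p x * (b x * Σ< L (V x))) ≡ Σ< L (λ j → e x * (p x * (b x * V x j)))
      pushIn x = sym (trans (Σ<-*ˡ L (e x) _) (cong (e x *_) (trans (Σ<-*ˡ L (p x) _) (cong (p x *_) (Σ<-*ˡ L (b x) (V x))))))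
      perPart : ∀ j → Σ< (suc B) (λ x → e x * (p x * (b x * V x j))) ≡ partTerm (suc L) i m k (suc j)
      perPart j = begin
        Σ< (suc B) (λ x → e x * (p x * (b x * V x j)))  ≡⟨ Σ<-cong (suc B) swapParts ⟩
        Σ< (suc B) (λ x → [ Q ≤ m ] * (g Q * R x))       ≡⟨ Σ<-*ˡ (suc B) [ Q ≤ m ] _ ⟩
        [ Q ≤ m ] * Σ< (suc B) (λ x → g Q * R x)         ≡⟨ cong ([ Q ≤ m ] *_) (Σ<-*ˡ (suc B) (g Q) R) ⟩
        [ Q ≤ m ] * (g Q * Σ< (suc B) R)                 ≡⟨ cong (λ n → [ n ≤ m ] * (g n * weightedSum (suc L) i (m ℕ.∸ n) k)) (ℕP.+-suc i j) ⟨
        partTerm (suc L) i m k (suc j)                   ∎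
        where
        Q = suc i ℕ.+ j
        W : ℕ → ℕ → ℚ
        W x n = weightedSum L (suc i) n (k ℕ.+ x)
        R : ℕ → ℚ
        R x = [ i ℕ.* x ≤ m ℕ.∸ Q ] * (p x * (b x * W x (m ℕ.∸ Q ℕ.∸ i ℕ.* x)))
        ∸-comm : ∀ x → m ℕ.∸ i ℕ.* x ℕ.∸ Q ≡ m ℕ.∸ Q ℕ.∸ i ℕ.* x
        ∸-comm x = trans (ℕP.∸-+-assoc m (i ℕ.* x) Q) (trans (cong (m ℕ.∸_) (ℕP.+-comm (i ℕ.* x) Q)) (sym (ℕP.∸-+-assoc m Q (i ℕ.* x))))
        brackets : ∀ x → e x * [ Q ≤ m ℕ.∸ i ℕ.* x ] ≡ [ Q ≤ m ] * [ i ℕ.* x ≤ m ℕ.∸ Q ]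
        brackets x = trans ([≤]-split (i ℕ.* x) Q m) (trans (cong [_≤ m ] (ℕP.+-comm (i ℕ.* x) Q)) (sym ([≤]-split Q (i ℕ.* x) m)))
        swapParts : ∀ x → e x * (p x * (b x * V x j)) ≡ [ Q ≤ m ] * (g Q * R x)
        swapParts x = begin
          e x * (p x * (b x * ([ Q ≤ m ℕ.∸ i ℕ.* x ] * (g Q * W x (m ℕ.∸ i ℕ.* x ℕ.∸ Q)))))
            ≡⟨ cong (λ n → e x * (p x * (b x * ([ Q ≤ m ℕ.∸ i ℕ.* x ] * (g Q * W x n))))) (∸-comm x) ⟩
          e x * (p x * (b x * ([ Q ≤ m ℕ.∸ i ℕ.* x ] * (g Q * w))))
            ≡⟨ *-solve 6 (λ e p b e′ y w → e ⊕ (p ⊕ (b ⊕ (e′ ⊕ (y ⊕ w)))) ⊜ (e ⊕ e′) ⊕ (y ⊕ (p ⊕ (b ⊕ w)))) refl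
                 (e x) (p x) (b x) [ Q ≤ m ℕ.∸ i ℕ.* x ] (g Q) w ⟩
          (e x * [ Q ≤ m ℕ.∸ i ℕ.* x ]) * (g Q * (p x * (b x * w)))
            ≡⟨ cong (_* (g Q * (p x * (b x * w)))) (brackets x) ⟩
          ([ Q ≤ m ] * [ i ℕ.* x ≤ m ℕ.∸ Q ]) * (g Q * (p x * (b x * w)))
            ≡⟨ *-solve 4 (λ e e′ y p → (e ⊕ e′) ⊕ (y ⊕ p) ⊜ e ⊕ (y ⊕ (e′ ⊕ p))) refl
                 [ Q ≤ m ] [ i ℕ.* x ≤ m ℕ.∸ Q ] (g Q) (p x * (b x * w)) ⟩
          [ Q ≤ m ] * (g Q * R x) ∎
          where
          w = W x (m ℕ.∸ Q ℕ.∸ i ℕ.* x)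

    -- The Pascal rule multinomial k t = multinomial (k - 1) t + Σ_l multinomial k (t - e_l), summed over the box.
    weightedSum-pascal : ∀ L i m k → 1 ℕ.≤ i → m ℕ.≤ B → 0 ℕ.< k ⊎ 0 ℕ.< m →
      weightedSum L i m k ≡ weightedSumPred L i m k + Σ< L (partTerm L i m k)
    weightedSum-pascal zero i m zero    _ _ (inj₂ 0<m) = trans ([≤]-no (ℕP.<⇒≱ 0<m)) (sym (+-identityʳ 0ℚ))
    weightedSum-pascal zero i m (suc k) _ _ _          = sym (+-identityʳ [ m ≤ 0 ])
    weightedSum-pascal (suc L) i m k 1≤i m≤B k+m>0 = begin
      weightedSum (suc L) i m k
        ≡⟨ Σ<-cong (suc B) (λ x → trans (cong (λ w → e x * (p x * (b x * w))) (inner x)) (distrib x)) ⟩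
      Σ< (suc B) (λ x → e x * (p x * (b x * pred x)) + e x * (p x * (b x * Σ< L (parts x))))
        ≡⟨ Σ<-+ (suc B) _ _ ⟩
      Σ< (suc B) (λ x → e x * (p x * (b x * pred x))) + Σ< (suc B) (λ x → e x * (p x * (b x * Σ< L (parts x))))
        ≡⟨ cong₂ _+_ (Σ-predTerms L i m k 1≤i m≤B) (Σ-partTerms L i m k) ⟩
      (weightedSumPred (suc L) i m k + partTerm (suc L) i m k 0) + Σ< L (λ j → partTerm (suc L) i m k (suc j))
        ≡⟨ +-assoc (weightedSumPred (suc L) i m k) _ _ ⟩
      weightedSumPred (suc L) i m k + (partTerm (suc L) i m k 0 + Σ< L (λ j → partTerm (suc L) i m k (suc j)))
        ≡⟨ cong (weightedSumPred (suc L) i m k +_) (Σ<-sucˡ L (partTerm (suc L) i m k)) ⟨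
      weightedSumPred (suc L) i m k + Σ< (suc L) (partTerm (suc L) i m k) ∎
      where
      open ≡-Reasoning
      e p b pred : ℕ → ℚ
      e x = [ i ℕ.* x ≤ m ]
      p x = g i ^ℚ x
      b x = binomℚ (k ℕ.+ x) x
      pred x = weightedSumPred L (suc i) (m ℕ.∸ i ℕ.* x) (k ℕ.+ x)
      parts : ℕ → ℕ → ℚ
      parts x = partTerm L (suc i) (m ℕ.∸ i ℕ.* x) (k ℕ.+ x)
      positive : 0 ℕ.< k ⊎ 0 ℕ.< m → ∀ x → 0 ℕ.< k ℕ.+ x ⊎ 0 ℕ.< m ℕ.∸ i ℕ.* x
      positive (inj₁ 0<k) zero    = inj₁ (subst (0 ℕ.<_) (sym (ℕP.+-identityʳ k)) 0<k)
      positive (inj₂ 0<m) zero    = inj₂ (subst (λ n → 0 ℕ.< m ℕ.∸ n) (sym (ℕP.*-zeroʳ i)) 0<m)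
      positive _          (suc x) = inj₁ (ℕP.<-≤-trans (s≤s z≤n) (ℕP.m≤n+m (suc x) k))
      inner : ∀ x → weightedSum L (suc i) (m ℕ.∸ i ℕ.* x) (k ℕ.+ x) ≡ pred x + Σ< L (parts x)
      inner x = weightedSum-pascal L (suc i) (m ℕ.∸ i ℕ.* x) (k ℕ.+ x)
                  (s≤s z≤n) (ℕP.≤-trans (ℕP.m∸n≤m m (i ℕ.* x)) m≤B) (positive k+m>0 x)
      distrib : ∀ x → e x * (p x * (b x * (pred x + Σ< L (parts x)))) ≡ e x * (p x * (b x * pred x)) + e x * (p x * (b x * Σ< L (parts x)))
      distrib x = solve 5 (λ e p b u v → e :* (p :* (b :* (u :+ v))) := e :* (p :* (b :* u)) :+ e :* (p :* (b :* v))) refl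
                    (e x) (p x) (b x) (pred x) (Σ< L (parts x))

    weightedSum-zero : ∀ L i k → 1 ℕ.≤ i → weightedSum L i 0 k ≡ 1ℚ
    weightedSum-zero zero    i       k _ = refl
    weightedSum-zero (suc L) (suc i) k _ = begin
      weightedSum (suc L) (suc i) 0 k
        ≡⟨ Σ<-sucˡ B _ ⟩
      first + Σ< B (λ x → [ suc i ℕ.* suc x ≤ 0 ] * rest x)
        ≡⟨ cong₂ _+_ first≡1 (Σ<-zero B (λ x → *-zeroˡ (rest x))) ⟩
      1ℚ + 0ℚ
        ≡⟨ +-identityʳ 1ℚ ⟩
      1ℚ ∎
      where
      open ≡-Reasoning
      rest : ℕ → ℚ
      rest x = g (suc i) ^ℚ suc x * (binomℚ (k ℕ.+ suc x) (suc x) * weightedSum L (suc (suc i)) (0 ℕ.∸ suc i ℕ.* suc x) (k ℕ.+ suc x))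
      first = [ suc i ℕ.* 0 ≤ 0 ] * (1ℚ * (binomℚ (k ℕ.+ 0) 0 * weightedSum L (suc (suc i)) (0 ℕ.∸ suc i ℕ.* 0) (k ℕ.+ 0)))
      first≡1 : first ≡ 1ℚ
      first≡1 = begin
        first
          ≡⟨ cong (λ n → [ n ≤ 0 ] * (1ℚ * (binomℚ (k ℕ.+ 0) 0 * weightedSum L (suc (suc i)) (0 ℕ.∸ n) (k ℕ.+ 0)))) (ℕP.*-zeroʳ (suc i)) ⟩
        [ 0 ≤ 0 ] * (1ℚ * (binomℚ (k ℕ.+ 0) 0 * weightedSum L (suc (suc i)) 0 (k ℕ.+ 0)))
          ≡⟨ cong (λ w → [ 0 ≤ 0 ] * (1ℚ * (binomℚ (k ℕ.+ 0) 0 * w))) (weightedSum-zero L (suc (suc i)) (k ℕ.+ 0) (s≤s z≤n)) ⟩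
        [ 0 ≤ 0 ] * (1ℚ * (binomℚ (k ℕ.+ 0) 0 * 1ℚ))
          ≡⟨⟩
        1ℚ ∎

    module _ (a : ℕ → ℚ) (a₀≡1 : a 0 ≡ 1ℚ) (a-rec : ∀ m → a (suc m) ≡ Σ< (suc m) (λ j → g (suc j) * a (m ℕ.∸ j))) where

      weightedSum≡a : ∀ L m → m ℕ.≤ B → m ℕ.≤ L → weightedSum L 1 m 0 ≡ a m
      weightedSum≡a L = <-rec _ step
        where
        step : ∀ m → (∀ {j} → j ℕ.< m → j ℕ.≤ B → j ℕ.≤ L → weightedSum L 1 j 0 ≡ a j) → m ℕ.≤ B → m ℕ.≤ L → weightedSum L 1 m 0 ≡ a m
        step zero    _  _   _   = trans (weightedSum-zero L 1 0 (s≤s z≤n)) (sym a₀≡1)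
        step (suc m) ih m<B m<L = begin
          weightedSum L 1 (suc m) 0                  ≡⟨ weightedSum-pascal L 1 (suc m) 0 (s≤s z≤n) m<B (inj₂ (s≤s z≤n)) ⟩
          0ℚ + Σ< L h                                ≡⟨ +-identityˡ _ ⟩
          Σ< L h                                     ≡⟨ cong (λ n → Σ< n h) (ℕP.m∸n+n≡m m<L) ⟨
          Σ< (L ℕ.∸ suc m ℕ.+ suc m) h               ≡⟨ Σ<-vanishing (suc m) (L ℕ.∸ suc m) h vanish ⟩
          Σ< (suc m) h                               ≡⟨ Σ<-cong-< (suc m) lower ⟩
          Σ< (suc m) (λ j → g (suc j) * a (m ℕ.∸ j)) ≡⟨ a-rec m ⟨
          a (suc m)                                  ∎
          where
          open ≡-Reasoning
          h : ℕ → ℚ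
          h = partTerm L 1 (suc m) 0
          vanish : ∀ j → suc m ℕ.≤ j → h j ≡ 0ℚ
          vanish j m<j = trans (cong (_* rest) ([≤]-no (ℕP.<⇒≱ (s≤s m<j)))) (*-zeroˡ rest)
            where rest = g (suc j) * weightedSum L 1 (m ℕ.∸ j) 0
          lower : ∀ j → j ℕ.< suc m → h j ≡ g (suc j) * a (m ℕ.∸ j)
          lower j (s≤s j≤m) = begin
            [ suc j ≤ suc m ] * (g (suc j) * weightedSum L 1 (m ℕ.∸ j) 0)
              ≡⟨ cong (_* (g (suc j) * weightedSum L 1 (m ℕ.∸ j) 0)) ([≤]-yes (s≤s j≤m)) ⟩
            1ℚ * (g (suc j) * weightedSum L 1 (m ℕ.∸ j) 0)
              ≡⟨ *-identityˡ (g (suc j) * weightedSum L 1 (m ℕ.∸ j) 0) ⟩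
            g (suc j) * weightedSum L 1 (m ℕ.∸ j) 0
              ≡⟨ cong (g (suc j) *_) (ih (s≤s m∸j≤m) (ℕP.≤-trans m∸j≤m (ℕP.<⇒≤ m<B)) (ℕP.≤-trans m∸j≤m (ℕP.<⇒≤ m<L))) ⟩
            g (suc j) * a (m ℕ.∸ j) ∎
            where m∸j≤m = ℕP.m∸n≤m m j

  compositionSum : (ℕ → ℚ) → ℕ → ℚ
  compositionSum g n = sumL (map (λ t → multinom t * monomial g 1 t) (filter (λ t → weighted 1 t ℕ.≟ n) (allVecs n n)))

  compositionSum≡recursive : ∀ (g a : ℕ → ℚ) → a 0 ≡ 1ℚ → (∀ m → a (suc m) ≡ Σ< (suc m) (λ j → g (suc j) * a (m ℕ.∸ j))) →
                             ∀ n → compositionSum g n ≡ a n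
  compositionSum≡recursive g a a₀≡1 a-rec n = begin
    compositionSum g n
      ≡⟨ sumL-filter (λ t → weighted 1 t ℕ.≟ n) _ (allVecs n n) ⟩
    sumL (map (λ t → if ⌊ weighted 1 t ℕ.≟ n ⌋ then multinom t * monomial g 1 t else 0ℚ) (allVecs n n))
      ≡⟨ sumL-allVecs n n _ ⟩
    boxSum n n (λ t → if ⌊ weighted 1 t ℕ.≟ n ⌋ then multinom t * monomial g 1 t else 0ℚ)
      ≡⟨ boxSum-cong n n (λ t → trans (if-≟≡[≡]* (weighted 1 t) n _) (cong (λ x → [ weighted 1 t ≡ n ] * (x * monomial g 1 t)) (multinom≡multinomial t))) ⟩
    boxSum n n (λ t → [ weighted 1 t ≡ n ] * (ℕ→ℚ (multinomial 0 t) * monomial g 1 t))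
      ≡⟨ boxSum≡weightedSum n g n 1 n 0 ⟩
    weightedSum n g n 1 n 0
      ≡⟨ weightedSum≡a n g a a₀≡1 a-rec n n ℕP.≤-refl ℕP.≤-refl ⟩
    a n ∎
    where open ≡-Reasoning

  sumV≤weighted : ∀ {L} p (t : Vec ℕ L) → sumV t ℕ.≤ weighted (suc p) t
  sumV≤weighted p []      = z≤n
  sumV≤weighted p (x ∷ t) = subst (x ℕ.+ sumV t ℕ.≤_) (sym (ℕP.+-assoc x (p ℕ.* x) _))
    (ℕP.+-monoʳ-≤ x (ℕP.≤-trans (sumV≤weighted (suc p) t) (ℕP.m≤n+m _ (p ℕ.* x))))

  weighted∸sumV : ∀ {L} p x (t : Vec ℕ L) →
    weighted (suc p) (x ∷ t) ℕ.∸ sumV (x ∷ t) ≡ p ℕ.* x ℕ.+ (weighted (suc (suc p)) t ℕ.∸ sumV t)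
  weighted∸sumV p x t = begin
    x ℕ.+ p ℕ.* x ℕ.+ weighted (suc (suc p)) t ℕ.∸ (x ℕ.+ sumV t)     ≡⟨ cong (ℕ._∸ (x ℕ.+ sumV t)) (ℕP.+-assoc x (p ℕ.* x) _) ⟩
    x ℕ.+ (p ℕ.* x ℕ.+ weighted (suc (suc p)) t) ℕ.∸ (x ℕ.+ sumV t)   ≡⟨ ℕP.[m+n]∸[m+o]≡n∸o x _ (sumV t) ⟩
    p ℕ.* x ℕ.+ weighted (suc (suc p)) t ℕ.∸ sumV t                   ≡⟨ ℕP.+-∸-assoc (p ℕ.* x) (sumV≤weighted (suc p) t) ⟩
    p ℕ.* x ℕ.+ (weighted (suc (suc p)) t ℕ.∸ sumV t)                 ∎
    where open ≡-Reasoning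

  -- Since Σ_l (p + l) t_l = (Σ_l (p + 1 + l) t_l) - |t|, each part of size p + 1 + l carries the sign (-1)^(p + l).
  sgn-monomial : ∀ {r g : ℕ → ℚ} → (∀ j → g (suc j) ≡ sgn j * r (suc j)) →
                 ∀ {L} p (t : Vec ℕ L) → sgn (weighted (suc p) t ℕ.∸ sumV t) * monomial r (suc p) t ≡ monomial g (suc p) t
  sgn-monomial         g≡ p []      = refl
  sgn-monomial {r} {g} g≡ p (x ∷ t) = begin
    sgn (weighted (suc p) (x ∷ t) ℕ.∸ sumV (x ∷ t)) * (r (suc p) ^ℚ x * M)
                                                       ≡⟨ cong (λ n → sgn n * (r (suc p) ^ℚ x * M)) (weighted∸sumV p x t) ⟩
    sgn (p ℕ.* x ℕ.+ e) * (r (suc p) ^ℚ x * M)         ≡⟨ cong (_* (r (suc p) ^ℚ x * M)) (sgn-+ (p ℕ.* x) e) ⟩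
    sgn (p ℕ.* x) * sgn e * (r (suc p) ^ℚ x * M)       ≡⟨ cong (λ s → s * sgn e * (r (suc p) ^ℚ x * M)) (^ℚ-*-assoc (- 1ℚ) p x) ⟨
    sgn p ^ℚ x * sgn e * (r (suc p) ^ℚ x * M)          ≡⟨ *-solve 4 (λ a b c d → (a ⊕ b) ⊕ (c ⊕ d) ⊜ (a ⊕ c) ⊕ (b ⊕ d)) refl (sgn p ^ℚ x) (sgn e) (r (suc p) ^ℚ x) M ⟩
    (sgn p ^ℚ x * r (suc p) ^ℚ x) * (sgn e * M)        ≡⟨ cong₂ _*_ (sym (*-distrib-^ℚ (sgn p) (r (suc p)) x)) (sgn-monomial g≡ (suc p) t) ⟩
    (sgn p * r (suc p)) ^ℚ x * monomial g (suc (suc p)) t ≡⟨ cong (λ y → y ^ℚ x * monomial g (suc (suc p)) t) (g≡ p) ⟨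
    g (suc p) ^ℚ x * monomial g (suc (suc p)) t        ∎
    where
    open ≡-Reasoning
    e = weighted (suc (suc p)) t ℕ.∸ sumV t
    M = monomial r (suc (suc p)) t

  -- Hypergeometric Cauchy numbers

  rising-1 : ∀ k → rising 1 k ≡ fact k
  rising-1 zero    = refl
  rising-1 (suc k) rewrite rising-1 k = ℕP.*-comm (fact k) (suc k)

  rising-*-+ : ∀ N k → rising N k ℕ.* (N ℕ.+ k) ≡ N ℕ.* rising (suc N) k
  rising-*-+ N zero = trans (ℕP.*-identityˡ (N ℕ.+ 0)) (trans (ℕP.+-identityʳ N) (sym (ℕP.*-identityʳ N)))
  rising-*-+ N (suc k) = begin
    rising N k ℕ.* (N ℕ.+ k) ℕ.* (N ℕ.+ suc k)    ≡⟨ cong₂ ℕ._*_ (rising-*-+ N k) (ℕP.+-suc N k) ⟩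
    N ℕ.* rising (suc N) k ℕ.* (suc N ℕ.+ k)      ≡⟨ ℕP.*-assoc N _ _ ⟩
    N ℕ.* rising (suc N) (suc k)                  ∎
    where open ≡-Reasoning

  0<rising : ∀ x n → 0 ℕ.< x → 0 ℕ.< rising x n
  0<rising x zero    0<x = s≤s z≤n
  0<rising x (suc n) 0<x = 0<* (0<rising x n 0<x) (ℕP.<-≤-trans 0<x (ℕP.m≤m+n x n))

  hyp2F1-1-N-[N+1] : ∀ N k → 0 ℕ.< N → hyp2F1 1 N (suc N) k ≡ N /ℕ (N ℕ.+ k)
  hyp2F1-1-N-[N+1] N k 0<N =
    /ℕ-≡ _ N (0<* (0<rising (suc N) k (s≤s z≤n)) (0<fact k)) (ℕP.<-≤-trans 0<N (ℕP.m≤m+n N k)) (begin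
      rising 1 k ℕ.* rising N k ℕ.* (N ℕ.+ k)     ≡⟨ cong (λ z → z ℕ.* rising N k ℕ.* (N ℕ.+ k)) (rising-1 k) ⟩
      fact k ℕ.* rising N k ℕ.* (N ℕ.+ k)         ≡⟨ ℕP.*-assoc (fact k) _ _ ⟩
      fact k ℕ.* (rising N k ℕ.* (N ℕ.+ k))       ≡⟨ cong (fact k ℕ.*_) (rising-*-+ N k) ⟩
      fact k ℕ.* (N ℕ.* rising (suc N) k)         ≡⟨ x∙yz≈y∙xz (fact k) N _ ⟩
      N ℕ.* (fact k ℕ.* rising (suc N) k)         ≡⟨ cong (N ℕ.*_) (ℕP.*-comm (fact k) _) ⟩
      N ℕ.* (rising (suc N) k ℕ.* fact k)         ∎)
    where open ≡-Reasoning

  Fcoeff≡sgn*N/[N+k] : ∀ N k → 0 ℕ.< N → Fcoeff N k ≡ sgn k * (N /ℕ (N ℕ.+ k))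
  Fcoeff≡sgn*N/[N+k] N k 0<N = cong (sgn k *_) (hyp2F1-1-N-[N+1] N k 0<N)

  powProd≡monomial : ∀ N {L} i (t : Vec ℕ L) → powProd N i t ≡ monomial (λ j → N /ℕ (N ℕ.+ j)) i t
  powProd≡monomial N i []      = refl
  powProd≡monomial N i (x ∷ t) = cong ((N /ℕ (N ℕ.+ i)) ^ℚ x *_) (powProd≡monomial N (suc i) t)

  cauchySum≡compositionSum : ∀ N n → 0 ℕ.< N → cauchySum N n ≡ compositionSum (λ j → - Fcoeff N j) n
  cauchySum≡compositionSum N n 0<N =
    sumL-filter-cong {A = Vec ℕ n} {P = λ t → weighted 1 t ≡ n} (λ t → weighted 1 t ℕ.≟ n)
                     {g = λ t → multinom t * monomial (λ j → - Fcoeff N j) 1 t} term≡ (allVecs n n)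
    where
    g≡ : ∀ j → - Fcoeff N (suc j) ≡ sgn j * (N /ℕ (N ℕ.+ suc j))
    g≡ j = trans (cong -_ (Fcoeff≡sgn*N/[N+k] N (suc j) 0<N))
                 (solve 2 (λ s x → :- ((con (- 1ℚ) :* s) :* x) := s :* x) refl (sgn j) (N /ℕ (N ℕ.+ suc j)))
    term≡ : ∀ (t : Vec ℕ n) → weighted 1 t ≡ n → multinom t * (sgn (n ℕ.∸ sumV t) * powProd N 1 t) ≡ multinom t * monomial (λ j → - Fcoeff N j) 1 t
    term≡ t w = cong (multinom t *_) (begin
      sgn (n ℕ.∸ sumV t) * powProd N 1 t                                  ≡⟨ cong (λ m → sgn (m ℕ.∸ sumV t) * powProd N 1 t) w ⟨
      sgn (weighted 1 t ℕ.∸ sumV t) * powProd N 1 t                       ≡⟨ cong (sgn (weighted 1 t ℕ.∸ sumV t) *_) (powProd≡monomial N 1 t) ⟩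
      sgn (weighted 1 t ℕ.∸ sumV t) * monomial (λ j → N /ℕ (N ℕ.+ j)) 1 t ≡⟨ sgn-monomial g≡ 0 t ⟩
      monomial (λ j → - Fcoeff N j) 1 t                                   ∎)
      where open ≡-Reasoning

  sgn*Fcoeff≡N/[N+n] : ∀ N n → 0 ℕ.< N → sgn n * Fcoeff N n ≡ N /ℕ (N ℕ.+ n)
  sgn*Fcoeff≡N/[N+n] N n 0<N = begin
    sgn n * Fcoeff N n                     ≡⟨ cong (sgn n *_) (Fcoeff≡sgn*N/[N+k] N n 0<N) ⟩
    sgn n * (sgn n * (N /ℕ (N ℕ.+ n)))     ≡⟨ *-assoc (sgn n) (sgn n) _ ⟨
    sgn n * sgn n * (N /ℕ (N ℕ.+ n))       ≡⟨ cong (_* (N /ℕ (N ℕ.+ n))) (sgn-*-sgn n) ⟩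
    1ℚ * (N /ℕ (N ℕ.+ n))                  ≡⟨ *-identityˡ _ ⟩
    N /ℕ (N ℕ.+ n)                         ∎
    where open ≡-Reasoning

  c≡fact*[c/fact] : ∀ (c : ℕ → ℚ) n → c n ≡ ℕ→ℚ (fact n) * (c n * (1 /ℕ fact n))
  c≡fact*[c/fact] c n = begin
    c n                                     ≡⟨ *-identityʳ (c n) ⟨
    c n * 1ℚ                                ≡⟨ cong (c n *_) (ℕ→ℚ-*-1/ℕ (fact n) (0<fact n)) ⟨
    c n * (ℕ→ℚ (fact n) * (1 /ℕ fact n))    ≡⟨ *-solve 3 (λ x f i → x ⊕ (f ⊕ i) ⊜ f ⊕ (x ⊕ i)) refl (c n) (ℕ→ℚ (fact n)) (1 /ℕ fact n) ⟩
    ℕ→ℚ (fact n) * (c n * (1 /ℕ fact n))    ∎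
    where open ≡-Reasoning

  cauchyMatrix≡hessenberg : ∀ c n (i j : Fin n) → cauchyMatrix c n i j ≡ hessenberg (λ m → c m * (1 /ℕ fact m)) (toℕ i) (toℕ j)
  cauchyMatrix≡hessenberg c n i j with toℕ j ℕ.≤? toℕ i
  ... | yes j≤i = sym (hessenberg-≤ _ j≤i)
  ... | no  j≰i with toℕ j ℕ.≟ suc (toℕ i)
  ...   | yes j≡i+1 rewrite j≡i+1 = sym (hessenberg-suc _ (toℕ i))
  ...   | no  j≢i+1 = sym (hessenberg-> _ j≰i j≢i+1)

open import Defs
open import Data.Nat using (ℕ; _≥_; _+_)
open import Data.Rational using (ℚ; 1ℚ; _*_; -_)
open import Data.Product using (_×_; _,_)
open import Relation.Binary.PropositionalEquality using (_≡_; refl; sym; cong; module ≡-Reasoning)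
open HypergeometricCauchyNumbers

corollary1 : (N n : ℕ) → N ≥ 1 → n ≥ 1 → (c : ℕ → ℚ) → IsHypCauchy N c →
    (c n ≡ ℕ→ℚ (fact n) * cauchySum N n)
    × (N /ℕ (N + n) ≡ det n (cauchyMatrix c n))
corollary1 N n N≥1 _ c cauchy = explicitFormula , determinantFormula
  where
  open ≡-Reasoning
  a : ℕ → ℚ
  a m = c m * (1 /ℕ fact m)
  b : ℕ → ℚ
  b = Fcoeff N
  b₀≡1 : b 0 ≡ 1ℚ
  b₀≡1 = refl
  b⁻¹≡a : b IsConvolutionInverseOf a
  b⁻¹≡a = cauchy
  explicitFormula : c n ≡ ℕ→ℚ (fact n) * cauchySum N n
  explicitFormula = begin
    c n                                                   ≡⟨ c≡fact*[c/fact] c n ⟩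
    ℕ→ℚ (fact n) * a n                                    ≡⟨ cong (ℕ→ℚ (fact n) *_) a≡compositionSum ⟩
    ℕ→ℚ (fact n) * compositionSum (λ j → - b j) n         ≡⟨ cong (ℕ→ℚ (fact n) *_) (cauchySum≡compositionSum N n N≥1) ⟨
    ℕ→ℚ (fact n) * cauchySum N n                          ∎
    where
    a≡compositionSum : a n ≡ compositionSum (λ j → - b j) n
    a≡compositionSum = sym (compositionSum≡recursive (λ j → - b j) a
      (convolutionInverse-head a b b₀≡1 b⁻¹≡a) (convolutionInverse-rec a b b₀≡1 b⁻¹≡a) n)
  determinantFormula : N /ℕ (N + n) ≡ det n (cauchyMatrix c n)
  determinantFormula = begin
    N /ℕ (N + n)               ≡⟨ sgn*Fcoeff≡N/[N+n] N n N≥1 ⟨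
    sgn n * b n                ≡⟨ hessenbergDet≡sgn*inverse a b b₀≡1 b⁻¹≡a n ⟨
    hessenbergDet a n          ≡⟨ det-cong n (cauchyMatrix≡hessenberg c n) ⟨
    det n (cauchyMatrix c n)   ∎
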